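{- For every $n\geq 3$, $$\Big|\bigsqcup_{b\geq 0,\,k\geq 0,\,2b+k+1=n}\mathrm{SYT}^{+k}((b+1,b))\Big|=\mathrm{Cat}(n)-\mathrm{Cat}(n-1)=\frac{3}{n+1}\binom{2n-2}{n},$$ and $$\Big|\bigsqcup_{b\geq 1,\,k\geq 0,\,2b+k+1=n}\mathrm{SYT}^{+k}((b+1,b)/(1))\Big|=\mathrm{Cat}(n)-2\,\mathrm{Cat}(n-1)+\mathrm{Cat}(n-2).$$
   Context: $\mathrm{Cat}(m)=\frac{1}{m+1}\binom{2m}{m}$ is the Catalan number. For a (possibly skew) shape $\lambda$ with $N$ cells (English convention) and $k\geq 0$, $\mathrm{SYT}^{+k}(\lambda)$ is the set of fillings $S$ of the cells of $\lambda$ by nonempty sets of positive integers forming a set partition of $[N+k]$, such that whenever $u\neq v$ are cells with $u$ weakly north and weakly west of $v$, $\max S(u)<\min S(v)$. The shape $(b+1,b)$ has $b+1$ cells in the top row and $b$ in the bottom row (for $b=0$ it is a single cell); $(b+1,b)/(1)$ is obtained from it by removing the top-left cell. -}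

module Defs where

open import Data.Nat using (ℕ; zero; suc; _+_; _*_; _∸_; _≤_; _≤ᵇ_; _/_)
import Data.Nat.Properties as ℕP
open import Data.Nat.Combinatorics using (_C_)
open import Data.Bool using (Bool; true; false; if_then_else_)
open import Data.Fin using (Fin; toℕ; _<_; _≟_) renaming (zero to fzero; suc to fsuc)
open import Data.Fin.Properties using (all?; any?; _<?_)
open import Data.Fin.Subset using (Subset; _∈_)
open import Data.Fin.Subset.Properties using (_∈?_)
open import Data.Vec using (Vec; []; _∷_)
open import Data.List using (List; []; _∷_; map; concatMap; filter; length; upTo; cartesianProduct)
open import Data.Nat.ListAction using (sum)
open import Data.Product using (_×_; _,_; ∃; proj₁; proj₂)
open import Relation.Binary.PropositionalEquality using (_≡_; _≢_)
open import Relation.Nullary using (Dec; ¬?)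
open import Relation.Nullary.Decidable using (_×-dec_; _→-dec_)

Cat : ℕ → ℕ
Cat m = ((2 * m) C m) / suc m

-- Shapes: a (possibly skew) shape with N cells is given by the
-- (row, column) coordinates of its cells, pos : Fin N → ℕ × ℕ
-- (English convention: row index increases going south,
--  column index increases going east).

NW : ℕ × ℕ → ℕ × ℕ → Set
NW (r , c) (r' , c') = (r ≤ r') × (c ≤ c')

NW? : ∀ p q → Dec (NW p q)
NW? (r , c) (r' , c') = (r ℕP.≤? r') ×-dec (c ℕP.≤? c')

-- Fillings of the N cells of the shape by subsets of [M] (the integers
-- 1..M are represented by Fin M, order-preservingly).
IsSYTplus : {N : ℕ} (pos : Fin N → ℕ × ℕ) (M : ℕ) → (Fin N → Subset M) → Set
IsSYTplus {N} pos M S =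
  (∀ c → ∃ λ i → i ∈ S c) ×
  (∀ i → ∃ λ c → i ∈ S c) ×
  (∀ i c d → i ∈ S c → i ∈ S d → c ≡ d) ×
  (∀ u v → u ≢ v → NW (pos u) (pos v) → ∀ i j → i ∈ S u → j ∈ S v → i < j)

IsSYTplus? : {N : ℕ} (pos : Fin N → ℕ × ℕ) (M : ℕ) → ∀ S → Dec (IsSYTplus pos M S)
IsSYTplus? pos M S =
  all? (λ c → any? (λ i → i ∈? S c)) ×-dec
  all? (λ i → any? (λ c → i ∈? S c)) ×-dec
  all? (λ i → all? (λ c → all? (λ d →
        (i ∈? S c) →-dec (i ∈? S d) →-dec (c ≟ d)))) ×-dec
  all? (λ u → all? (λ v → ¬? (u ≟ v) →-dec NW? (pos u) (pos v) →-dec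
        all? (λ i → all? (λ j → (i ∈? S u) →-dec (j ∈? S v) →-dec (i <? j)))))

allVecs : (A : Set) → List A → (m : ℕ) → List (Vec A m)
allVecs A xs zero = [] ∷ []
allVecs A xs (suc m) = concatMap (λ x → map (x ∷_) (allVecs A xs m)) xs

allSubsets : (m : ℕ) → List (Subset m)
allSubsets = allVecs Bool (false ∷ true ∷ [])

consFun : {A : Set} {n : ℕ} → A → (Fin n → A) → Fin (suc n) → A
consFun a f fzero = a
consFun a f (fsuc i) = f i

allFuns : {A : Set} → List A → (n : ℕ) → List (Fin n → A)
allFuns xs zero = (λ ()) ∷ []
allFuns xs (suc n) = concatMap (λ x → map (consFun x) (allFuns xs n)) xs

#SYTplus : (N : ℕ) (pos : Fin N → ℕ × ℕ) (k : ℕ) → ℕ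
#SYTplus N pos k =
  length (filter (IsSYTplus? pos (N + k)) (allFuns (allSubsets (N + k)) N))

-- The shape (b+1,b): 2b+1 cells; cell i (0-based) is in row 0, column i
-- for i ≤ b, and in row 1, column i-(b+1) otherwise.
posTwoRow : (b : ℕ) → Fin (2 * b + 1) → ℕ × ℕ
posTwoRow b i = if toℕ i ≤ᵇ b then (0 , toℕ i) else (1 , toℕ i ∸ suc b)

-- The skew shape (b+1,b)/(1): 2b cells; cell i is in row 0, column i+1
-- for i < b, and in row 1, column i-b otherwise.
posSkew : (b : ℕ) → Fin (2 * b) → ℕ × ℕ
posSkew b i = if suc (toℕ i) ≤ᵇ b then (0 , suc (toℕ i)) else (1 , toℕ i ∸ b)

-- Cardinality of a disjoint union over pairs (b,k) with 2b+k+1 = n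
-- (and b ≥ bmin): sum of the cardinalities.  Both b and k are ≤ n.
unionCount : (bmin n : ℕ) → (ℕ → ℕ → ℕ) → ℕ
unionCount bmin n f =
  sum (map (λ p → f (proj₁ p) (proj₂ p))
           (filter (λ p → (bmin ℕP.≤? proj₁ p) ×-dec
                           (2 * proj₁ p + proj₂ p + 1 ℕP.≟ n))
                   (cartesianProduct (upTo (suc n)) (upTo (suc n)))))

countTwoRow : ℕ → ℕ
countTwoRow n = unionCount 0 n (λ b k → #SYTplus (2 * b + 1) (posTwoRow b) k)

countSkew : ℕ → ℕ
countSkew n = unionCount 1 n (λ b k → #SYTplus (2 * b) (posSkew b) k)

-- Removing the smallest entry of a filling of a two-row shape leaves a filling
-- with one entry fewer, so these fillings are counted by weighted lattice walks
-- whose coordinates are the numbers of cells still open in each row.  Summing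
-- over the shapes (b + 1, b) the walks only see the gap between the two rows,
-- a one-dimensional walk counted by the ballot numbers
-- (2z + 1)/(L + z + 1) · C(2L, L - z): height 0 gives Cat(L), and the two-row
-- count is Cat(n) - Cat(n - 1).  A first step from (b + 1, b) either stays or
-- moves to (b, b), the skew shape, so the skew count is the difference of two
-- consecutive two-row counts, Cat(n) - 2 Cat(n - 1) + Cat(n - 2).

module Submission where

open import Data.Nat using (ℕ)
import Data.Nat as ℕ
open import Data.Fin using (Fin)
open import Data.Product using (_×_)
open import Relation.Binary.PropositionalEquality using (_≡_)

module Prelude where

  open import Data.Nat
  open import Data.Nat.Properties using (+-identityʳ; +-assoc; *-zeroʳ; *-distribˡ-+; +-commutativeSemigroup)
  open import Algebra.Properties.CommutativeSemigroup +-commutativeSemigroup using (interchange)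
  open import Data.Bool using (Bool; true; false; if_then_else_)
  open import Data.Empty using (⊥; ⊥-elim)
  open import Data.Product using (_×_; proj₁; proj₂)
  open import Data.Sum using (_⊎_; inj₁; inj₂; [_,_])
  open import Function using (_∘_)
  open import Relation.Binary.PropositionalEquality
  open import Relation.Nullary using (Dec; yes; no; does; contradiction)

  b2n : Bool → ℕ
  b2n true  = 1
  b2n false = 0

  if-true : ∀ {A : Set} {b} {x y : A} → b ≡ true → (if b then x else y) ≡ x
  if-true refl = refl

  if-false : ∀ {A : Set} {b} {x y : A} → b ≡ false → (if b then x else y) ≡ y
  if-false refl = refl

  <⇒<ᵇ≡true : ∀ {m n} → m < n → (m <ᵇ n) ≡ true
  <⇒<ᵇ≡true {zero}  {suc n} _         = refl
  <⇒<ᵇ≡true {suc m} {suc n} (s≤s m<n) = <⇒<ᵇ≡true m<n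

  ≥⇒<ᵇ≡false : ∀ {m n} → n ≤ m → (m <ᵇ n) ≡ false
  ≥⇒<ᵇ≡false {m}     {zero}  _         = refl
  ≥⇒<ᵇ≡false {suc m} {suc n} (s≤s n≤m) = ≥⇒<ᵇ≡false n≤m

  ≤⇒≤ᵇ≡true : ∀ {m n} → m ≤ n → (m ≤ᵇ n) ≡ true
  ≤⇒≤ᵇ≡true {zero}  _   = refl
  ≤⇒≤ᵇ≡true {suc m} m<n = <⇒<ᵇ≡true m<n

  >⇒≤ᵇ≡false : ∀ {m n} → n < m → (m ≤ᵇ n) ≡ false
  >⇒≤ᵇ≡false {suc m} (s≤s n≤m) = ≥⇒<ᵇ≡false n≤m

  does≡true⇒ : ∀ {A : Set} (a? : Dec A) → does a? ≡ true → A
  does≡true⇒ (yes a) _ = a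

  b2n-does-×-⊎ : ∀ {A L B D : Set} (a? : Dec A) (l? : Dec L) (b? : Dec B) (d? : Dec D) →
    (A → L × (B ⊎ D)) → (L → B ⊎ D → A) → (L → B → D → ⊥) →
    b2n (does a?) ≡ b2n (does l?) * (b2n (does b?) + b2n (does d?))
  b2n-does-×-⊎ (yes a) (no ¬l) _       _       to from excl = contradiction (proj₁ (to a)) ¬l
  b2n-does-×-⊎ (yes _) (yes l) (yes b) (yes d) to from excl = ⊥-elim (excl l b d)
  b2n-does-×-⊎ (yes _) (yes _) (yes _) (no _)  to from excl = refl
  b2n-does-×-⊎ (yes _) (yes _) (no _)  (yes _) to from excl = refl
  b2n-does-×-⊎ (yes a) (yes _) (no ¬b) (no ¬d) to from excl = ⊥-elim ([ ¬b , ¬d ] (proj₂ (to a)))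
  b2n-does-×-⊎ (no _)  (no _)  _       _       to from excl = refl
  b2n-does-×-⊎ (no ¬a) (yes l) (yes b) _       to from excl = contradiction (from l (inj₁ b)) ¬a
  b2n-does-×-⊎ (no ¬a) (yes l) (no _)  (yes d) to from excl = contradiction (from l (inj₂ d)) ¬a
  b2n-does-×-⊎ (no _)  (yes _) (no _)  (no _)  to from excl = refl

  cong₃ : ∀ {A B C D : Set} (f : A → B → C → D) {x x′ y y′ z z′} →
          x ≡ x′ → y ≡ y′ → z ≡ z′ → f x y z ≡ f x′ y′ z′
  cong₃ f refl refl refl = refl

  δ : ℕ → ℕ → ℕ
  δ zero    zero    = 1
  δ zero    (suc _) = 0
  δ (suc _) zero    = 0
  δ (suc a) (suc b) = δ a b

  δ-refl : ∀ a → δ a a ≡ 1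
  δ-refl zero    = refl
  δ-refl (suc a) = δ-refl a

  δ-≢ : ∀ {a b} → a ≢ b → δ a b ≡ 0
  δ-≢ {zero}  {zero}  a≢b = contradiction refl a≢b
  δ-≢ {zero}  {suc b} _   = refl
  δ-≢ {suc a} {zero}  _   = refl
  δ-≢ {suc a} {suc b} a≢b = δ-≢ (a≢b ∘ cong suc)

  sumBelow : ℕ → (ℕ → ℕ) → ℕ
  sumBelow zero    f = 0
  sumBelow (suc B) f = f 0 + sumBelow B (f ∘ suc)

  sumBelow-cong : ∀ B {f g} → (∀ b → f b ≡ g b) → sumBelow B f ≡ sumBelow B g
  sumBelow-cong zero    f≗g = refl
  sumBelow-cong (suc B) f≗g = cong₂ _+_ (f≗g 0) (sumBelow-cong B (λ b → f≗g (suc b)))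

  sumBelow-zero : ∀ B {f} → (∀ b → f b ≡ 0) → sumBelow B f ≡ 0
  sumBelow-zero zero    f≗0 = refl
  sumBelow-zero (suc B) f≗0 = cong₂ _+_ (f≗0 0) (sumBelow-zero B (λ b → f≗0 (suc b)))

  sumBelow-+ : ∀ B (f g : ℕ → ℕ) → sumBelow B (λ b → f b + g b) ≡ sumBelow B f + sumBelow B g
  sumBelow-+ zero    f g = refl
  sumBelow-+ (suc B) f g =
    trans (cong (f 0 + g 0 +_) (sumBelow-+ B (f ∘ suc) (g ∘ suc)))
          (interchange (f 0) (g 0) (sumBelow B (f ∘ suc)) (sumBelow B (g ∘ suc)))

  sumBelow-*ˡ : ∀ B x (f : ℕ → ℕ) → sumBelow B (λ b → x * f b) ≡ x * sumBelow B f
  sumBelow-*ˡ zero    x f = sym (*-zeroʳ x)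
  sumBelow-*ˡ (suc B) x f = trans (cong (x * f 0 +_) (sumBelow-*ˡ B x (f ∘ suc))) (sym (*-distribˡ-+ x (f 0) _))

  sumBelow-suc : ∀ B (f : ℕ → ℕ) → sumBelow (suc B) f ≡ sumBelow B f + f B
  sumBelow-suc zero    f = +-identityʳ (f 0)
  sumBelow-suc (suc B) f = trans (cong (f 0 +_) (sumBelow-suc B (f ∘ suc))) (sym (+-assoc (f 0) _ _))

  sumBelow-δ : ∀ B u (g : ℕ → ℕ) → u < B → sumBelow B (λ b → δ b u * g b) ≡ g u
  sumBelow-δ (suc B) zero    g _         = trans (cong₂ _+_ (+-identityʳ (g 0)) (sumBelow-zero B (λ _ → refl))) (+-identityʳ (g 0))
  sumBelow-δ (suc B) (suc u) g (s≤s u<B) = sumBelow-δ B u (g ∘ suc) u<B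

module Ballot where

  open import Data.Nat
  open import Data.Nat.Properties
  open import Data.Nat.DivMod using (m*n/n≡m)
  open import Data.Bool using (Bool; true; false)
  open import Defs using (Cat)
  open Prelude
  import Data.Nat.Combinatorics as ℕC
  open import Relation.Binary.PropositionalEquality
  open import Data.Nat.Tactic.RingSolver

  -- The binomial coefficient is kept abstract: letting Agda unfold the
  -- factorial-based ℕC._C_ makes type checking diverge.
  abstract
    infixl 6.5 _C_
    _C_ : ℕ → ℕ → ℕ
    _C_ = ℕC._C_

    C≡ℕC : ∀ n k → n C k ≡ n ℕC.C k
    C≡ℕC n k = refl

    [1+n]C[1+k]≡nCk+nC[1+k] : ∀ n k → suc n C suc k ≡ n C k + n C suc k
    [1+n]C[1+k]≡nCk+nC[1+k] n k = sym (ℕC.nCk+nC[k+1]≡[n+1]C[k+1] n k)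

    nC0≡1 : ∀ n → n C 0 ≡ 1
    nC0≡1 n = refl

    nC1≡n : ∀ n → n C 1 ≡ n
    nC1≡n = ℕC.nC1≡n

    n<k⇒nCk≡0 : ∀ {n k} → n < k → n C k ≡ 0
    n<k⇒nCk≡0 = ℕC.k>n⇒nCk≡0

    nCk≡nC[n∸k] : ∀ {n k} → k ≤ n → n C k ≡ n C (n ∸ k)
    nCk≡nC[n∸k] {n} {k} = ℕC.nCk≡nC[n∸k] {k} {n}

  Cpred : ℕ → ℕ → ℕ
  Cpred n zero    = 0
  Cpred n (suc k) = n C k

  -- Unlike 2 * m, this reduces when m is a successor.
  twice : ℕ → ℕ
  twice zero    = 0
  twice (suc m) = suc (suc (twice m))

  twice≡2* : ∀ m → twice m ≡ 2 * m
  twice≡2* zero    = refl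
  twice≡2* (suc m) = trans (cong (2 +_) (twice≡2* m)) (sym (*-suc 2 m))

  -- walks z p q L counts walks of length L on ℕ from height z to height 0 with
  -- unit up, down and level steps, where a level step has weight b2n p + b2n q
  -- (just b2n p at height 0); a down step sets p and an up step sets q.
  walks : ℕ → Bool → Bool → ℕ → ℕ
  walks zero    p q zero    = 1
  walks (suc z) p q zero    = 0
  walks zero    p q (suc L) = walks 1 p true L + b2n p * walks 0 p q L
  walks (suc z) p q (suc L) =
    walks (suc (suc z)) p true L + walks z true q L + (b2n p + b2n q) * walks (suc z) p q L

  ballot : ℕ → ℕ → ℕ
  ballot z L = walks z true true L

  walks-FT+walks-FT≡ballot : ∀ L z →
    walks (suc z) false true L + walks (suc (suc z)) false true L ≡ ballot (suc z) L
  walks-FT+walks-FT≡ballot zero    z = refl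
  walks-FT+walks-FT≡ballot (suc L) z = begin
      (w₂ + b₀ + (0 + 1) * w₁) + (w₃ + b₁ + (0 + 1) * w₂)
        ≡⟨ regroup w₁ w₂ w₃ b₀ b₁ ⟩
      (w₁ + w₂) + (w₂ + w₃) + b₀ + b₁
        ≡⟨ cong₂ (λ x y → x + y + b₀ + b₁) (walks-FT+walks-FT≡ballot L z) (walks-FT+walks-FT≡ballot L (suc z)) ⟩
      ballot (suc z) L + ballot (suc (suc z)) L + b₀ + ballot (suc z) L
        ≡⟨ regroup′ (ballot (suc z) L) (ballot (suc (suc z)) L) b₀ ⟩
      ballot (suc (suc z)) L + b₀ + (1 + 1) * ballot (suc z) L ∎
    where
    open ≡-Reasoning
    w₁ = walks (suc z) false true L
    w₂ = walks (suc (suc z)) false true L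
    w₃ = walks (suc (suc (suc z))) false true L
    b₀ = ballot z L
    b₁ = ballot (suc z) L
    regroup : ∀ a b c d e → (b + d + (0 + 1) * a) + (c + e + (0 + 1) * b) ≡ (a + b) + (b + c) + d + e
    regroup = solve-∀
    regroup′ : ∀ a b d → a + b + d + a ≡ b + d + (1 + 1) * a
    regroup′ = solve-∀

  walks0-TF≡ballot0 : ∀ L → walks 0 true false L ≡ ballot 0 L
  walks0-TF≡ballot0 zero    = refl
  walks0-TF≡ballot0 (suc L) = cong (λ x → ballot 1 L + 1 * x) (walks0-TF≡ballot0 L)

  walks1-FT≡ballot0 : ∀ L → walks 1 false true (suc L) ≡ ballot 0 (suc L)
  walks1-FT≡ballot0 L = begin
    walks 2 false true L + ballot 0 L + (0 + 1) * walks 1 false true L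
      ≡⟨ regroup (walks 2 false true L) (ballot 0 L) (walks 1 false true L) ⟩
    (walks 1 false true L + walks 2 false true L) + ballot 0 L
      ≡⟨ cong (_+ ballot 0 L) (walks-FT+walks-FT≡ballot L 0) ⟩
    ballot 1 L + ballot 0 L
      ≡⟨ cong (ballot 1 L +_) (sym (*-identityˡ _)) ⟩
    ballot 1 L + 1 * ballot 0 L ∎
    where
    open ≡-Reasoning
    regroup : ∀ a b c → a + b + (0 + 1) * c ≡ (c + a) + b
    regroup = solve-∀

  walks1-FF≡ballot1 : ∀ L → walks 1 false false (suc (suc L)) ≡ ballot 1 (suc L)
  walks1-FF≡ballot1 L = begin
    walks 2 false true (suc L) + walks 0 true false (suc L) + 0 * walks 1 false false (suc L)
      ≡⟨ cong₂ (λ x y → walks 2 false true (suc L) + x + y) (walks0-TF≡ballot0 (suc L)) (*-zeroˡ (walks 1 false false (suc L))) ⟩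
    walks 2 false true (suc L) + ballot 0 (suc L) + 0
      ≡⟨ cong (λ x → walks 2 false true (suc L) + x + 0) (sym (walks1-FT≡ballot0 L)) ⟩
    walks 2 false true (suc L) + walks 1 false true (suc L) + 0
      ≡⟨ regroup (walks 2 false true (suc L)) (walks 1 false true (suc L)) ⟩
    walks 1 false true (suc L) + walks 2 false true (suc L)
      ≡⟨ walks-FT+walks-FT≡ballot (suc L) 0 ⟩
    ballot 1 (suc L) ∎
    where
    open ≡-Reasoning
    regroup : ∀ a b → a + b + 0 ≡ b + a
    regroup = solve-∀

  ballot0-suc : ∀ L → ballot 0 (suc L) ≡ ballot 1 L + ballot 0 L
  ballot0-suc L = cong (ballot 1 L +_) (*-identityˡ _)

  L<z⇒ballot≡0 : ∀ {L z} → L < z → ballot z L ≡ 0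
  L<z⇒ballot≡0 {zero}  {suc z} _ = refl
  L<z⇒ballot≡0 {suc L} {suc z} (s≤s L<z)
    rewrite L<z⇒ballot≡0 {L} {suc (suc z)} (m<n⇒m<1+n (m<n⇒m<1+n L<z))
          | L<z⇒ballot≡0 {L} {z} L<z
          | L<z⇒ballot≡0 {L} {suc z} (m<n⇒m<1+n L<z) = refl

  [1+n]Ck≡Cpred+nCk : ∀ n k → suc n C k ≡ Cpred n k + n C k
  [1+n]Ck≡Cpred+nCk n zero    = trans (nC0≡1 (suc n)) (sym (nC0≡1 n))
  [1+n]Ck≡Cpred+nCk n (suc k) = [1+n]C[1+k]≡nCk+nC[1+k] n k

  [2+n]C[1+k]≡Cpred+2nCk+nC[1+k] : ∀ n k → suc (suc n) C suc k ≡ Cpred n k + n C k + n C k + n C suc k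
  [2+n]C[1+k]≡Cpred+2nCk+nC[1+k] n k = begin
    suc (suc n) C suc k                      ≡⟨ [1+n]C[1+k]≡nCk+nC[1+k] (suc n) k ⟩
    suc n C k + suc n C suc k                ≡⟨ cong₂ _+_ ([1+n]Ck≡Cpred+nCk n k) ([1+n]C[1+k]≡nCk+nC[1+k] n k) ⟩
    (Cpred n k + n C k) + (n C k + n C suc k) ≡⟨ regroup (Cpred n k) (n C k) (n C suc k) ⟩
    Cpred n k + n C k + n C k + n C suc k     ∎
    where
    open ≡-Reasoning
    regroup : ∀ a b c → (a + b) + (b + c) ≡ a + b + b + c
    regroup = solve-∀

  twice≡+ : ∀ L → twice L ≡ L + L
  twice≡+ L = trans (twice≡2* L) (cong (L +_) (+-identityʳ L))

  twice[1+L]C[2+L]≡C[L] : ∀ L → twice (suc L) C suc (suc L) ≡ twice (suc L) C L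
  twice[1+L]C[2+L]≡C[L] L = trans (nCk≡nC[n∸k] 2+L≤) (cong (twice (suc L) C_) diff)
    where
    2+L≤ : suc (suc L) ≤ twice (suc L)
    2+L≤ = s≤s (s≤s (subst (L ≤_) (sym (twice≡+ L)) (m≤m+n L L)))
    diff : twice (suc L) ∸ suc (suc L) ≡ L
    diff = trans (cong (_∸ L) (twice≡+ L)) (m+n∸n≡m L L)

  -- The ballot numbers are differences of consecutive binomial coefficients,
  -- stated additively: ballot z L = C(2L, k) - C(2L, k - 1) where z + k = L.
  BallotBinomial : ℕ → Set
  BallotBinomial L = ∀ z k → z + k ≡ L → ballot z L + Cpred (twice L) k ≡ twice L C k

  ballotBinomial-height0 : ∀ L → BallotBinomial L →
    ballot 0 (suc L) + Cpred (twice (suc L)) (suc L) ≡ twice (suc L) C suc L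
  ballotBinomial-height0 zero     ih = trans (cong (1 +_) (nC0≡1 2)) (sym (nC1≡n 2))
  ballotBinomial-height0 (suc L′) ih = begin
      b₁ + 1 * b₀ + Cpred (suc (suc n)) (suc (suc L′))
        ≡⟨ cong (b₁ + 1 * b₀ +_) ([2+n]C[1+k]≡Cpred+2nCk+nC[1+k] n L′) ⟩
      b₁ + 1 * b₀ + (Cpred n L′ + n C L′ + n C L′ + n C suc L′)
        ≡⟨ regroup b₁ b₀ (Cpred n L′) (n C L′) (n C suc L′) ⟩
      (b₁ + Cpred n L′) + (b₀ + n C L′) + n C L′ + n C suc L′
        ≡⟨ cong₂ (λ x y → x + y + n C L′ + n C suc L′) (ih 1 L′ refl) (ih 0 (suc L′) refl) ⟩
      n C L′ + n C suc L′ + n C L′ + n C suc L′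
        ≡⟨ regroup′ (n C L′) (n C suc L′) ⟩
      n C L′ + n C suc L′ + n C suc L′ + n C L′
        ≡⟨ cong (n C L′ + n C suc L′ + n C suc L′ +_) (twice[1+L]C[2+L]≡C[L] L′) ⟨
      n C L′ + n C suc L′ + n C suc L′ + n C suc (suc L′)
        ≡⟨ [2+n]C[1+k]≡Cpred+2nCk+nC[1+k] n (suc L′) ⟨
      suc (suc n) C suc (suc L′) ∎
    where
    open ≡-Reasoning
    n  = twice (suc L′)
    b₁ = ballot 1 (suc L′)
    b₀ = ballot 0 (suc L′)
    regroup : ∀ m₁ m₀ a b c → m₁ + 1 * m₀ + (a + b + b + c) ≡ (m₁ + a) + (m₀ + b) + b + c
    regroup = solve-∀
    regroup′ : ∀ x y → x + y + x + y ≡ x + y + y + x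
    regroup′ = solve-∀

  ballotBinomial-diagonal : ∀ L → BallotBinomial L →
    ballot (suc L) (suc L) + Cpred (twice (suc L)) 0 ≡ twice (suc L) C 0
  ballotBinomial-diagonal L ih
    rewrite L<z⇒ballot≡0 {L} {suc (suc L)} (m<n⇒m<1+n (n<1+n L))
          | L<z⇒ballot≡0 {L} {suc L} (n<1+n L)
          | +-identityʳ (ballot L L)
          | +-identityʳ (ballot L L)
    = trans (sym (+-identityʳ (ballot L L)))
            (trans (ih L 0 (+-identityʳ L)) (trans (nC0≡1 (twice L)) (sym (nC0≡1 (twice (suc L))))))

  ballotBinomial-subdiagonal : ∀ z → BallotBinomial (suc z) →
    ballot (suc z) (suc (suc z)) + Cpred (twice (suc (suc z))) 1 ≡ twice (suc (suc z)) C 1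
  ballotBinomial-subdiagonal z ih
    rewrite L<z⇒ballot≡0 {suc z} {suc (suc z)} (n<1+n (suc z))
          | nC1≡n (twice (suc (suc z)))
          | nC0≡1 (twice (suc (suc z)))
    = trans (regroup (ballot z (suc z)) (ballot (suc z) (suc z)))
            (trans (cong₂ (λ a b → a + 2 * b) diag₁ diag₀) (regroup′ (twice (suc z))))
    where
    diag₀ : ballot (suc z) (suc z) + 0 ≡ 1
    diag₀ = trans (ih (suc z) 0 (+-identityʳ (suc z))) (nC0≡1 (twice (suc z)))
    diag₁ : ballot z (suc z) + 1 ≡ twice (suc z)
    diag₁ = trans (cong (ballot z (suc z) +_) (sym (nC0≡1 (twice (suc z)))))
                  (trans (ih z 1 (+-comm z 1)) (nC1≡n (twice (suc z))))
    regroup : ∀ a b → 0 + a + (1 + 1) * b + 1 ≡ (a + 1) + 2 * (b + 0)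
    regroup = solve-∀
    regroup′ : ∀ n → n + 2 * 1 ≡ suc (suc n)
    regroup′ = solve-∀

  ballotBinomial-generic : ∀ L z k → BallotBinomial L → suc z + suc (suc k) ≡ suc L →
    ballot (suc z) (suc L) + Cpred (twice (suc L)) (suc (suc k)) ≡ twice (suc L) C suc (suc k)
  ballotBinomial-generic L z k ih eq = begin
      b₂ + b₀ + (1 + 1) * b₁ + Cpred (suc (suc n)) (suc (suc k))
        ≡⟨ cong (b₂ + b₀ + (1 + 1) * b₁ +_) ([2+n]C[1+k]≡Cpred+2nCk+nC[1+k] n k) ⟩
      b₂ + b₀ + (1 + 1) * b₁ + (Cpred n k + n C k + n C k + n C suc k)
        ≡⟨ regroup b₂ b₀ b₁ (Cpred n k) (n C k) (n C suc k) ⟩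
      (b₂ + Cpred n k) + (b₀ + n C suc k) + 2 * (b₁ + n C k)
        ≡⟨ cong₂ (λ x y → x + y + 2 * (b₁ + n C k)) (ih (suc (suc z)) k e₂) (ih z (suc (suc k)) e₀) ⟩
      n C k + n C suc (suc k) + 2 * (b₁ + n C k)
        ≡⟨ cong (λ x → n C k + n C suc (suc k) + 2 * x) (ih (suc z) (suc k) e₁) ⟩
      n C k + n C suc (suc k) + 2 * (n C suc k)
        ≡⟨ regroup′ (n C k) (n C suc k) (n C suc (suc k)) ⟩
      n C k + n C suc k + n C suc k + n C suc (suc k)
        ≡⟨ [2+n]C[1+k]≡Cpred+2nCk+nC[1+k] n (suc k) ⟨
      suc (suc n) C suc (suc k) ∎
    where
    open ≡-Reasoning
    n  = twice L
    b₂ = ballot (suc (suc z)) L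
    b₁ = ballot (suc z) L
    b₀ = ballot z L
    e₀ : z + suc (suc k) ≡ L
    e₀ = suc-injective eq
    e₁ : suc z + suc k ≡ L
    e₁ = trans (sym (+-suc z (suc k))) e₀
    e₂ : suc (suc z) + k ≡ L
    e₂ = trans (cong suc (sym (+-suc z k))) e₁
    regroup : ∀ m₂ m₀ m₁ a b c → m₂ + m₀ + (1 + 1) * m₁ + (a + b + b + c) ≡ (m₂ + a) + (m₀ + c) + 2 * (m₁ + b)
    regroup = solve-∀
    regroup′ : ∀ b c d → b + d + 2 * c ≡ b + c + c + d
    regroup′ = solve-∀

  ballotBinomial : ∀ L → BallotBinomial L
  ballotBinomial zero    zero    zero    _  = sym (nC0≡1 0)
  ballotBinomial (suc L) zero    (suc .L) refl = ballotBinomial-height0 L (ballotBinomial L)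
  ballotBinomial (suc L) (suc z) zero eq
    with refl ← trans (sym (+-identityʳ z)) (suc-injective eq) = ballotBinomial-diagonal L (ballotBinomial L)
  ballotBinomial (suc L) (suc z) (suc zero) eq
    with refl ← trans (+-comm 1 z) (suc-injective eq) = ballotBinomial-subdiagonal z (ballotBinomial L)
  ballotBinomial (suc L) (suc z) (suc (suc k)) eq = ballotBinomial-generic L z k (ballotBinomial L) eq

  [1+k]*[1+n]C[1+k]≡[1+n]*nCk : ∀ n k → suc k * (suc n C suc k) ≡ suc n * (n C k)
  [1+k]*[1+n]C[1+k]≡[1+n]*nCk zero zero = cong (_+ 0) (trans (nC1≡n 1) (sym (nC0≡1 0)))
  [1+k]*[1+n]C[1+k]≡[1+n]*nCk zero (suc k)
    rewrite n<k⇒nCk≡0 {1} {suc (suc k)} (s≤s (s≤s z≤n)) | n<k⇒nCk≡0 {0} {suc k} (s≤s z≤n) = *-zeroʳ (suc (suc k))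
  [1+k]*[1+n]C[1+k]≡[1+n]*nCk (suc n) zero =
    trans (+-identityʳ _) (trans (nC1≡n _) (trans (sym (*-identityʳ (suc (suc n)))) (cong (suc (suc n) *_) (sym (nC0≡1 (suc n))))))
  [1+k]*[1+n]C[1+k]≡[1+n]*nCk (suc n) (suc k) = begin
      suc (suc k) * (suc (suc n) C suc (suc k))
        ≡⟨ cong (suc (suc k) *_) ([1+n]C[1+k]≡nCk+nC[1+k] (suc n) (suc k)) ⟩
      suc (suc k) * (suc n C suc k + suc n C suc (suc k))
        ≡⟨ regroup (suc n C suc k) (suc n C suc (suc k)) k ⟩
      suc n C suc k + suc k * (suc n C suc k) + suc (suc k) * (suc n C suc (suc k))
        ≡⟨ cong₂ (λ x y → suc n C suc k + x + y) ([1+k]*[1+n]C[1+k]≡[1+n]*nCk n k) ([1+k]*[1+n]C[1+k]≡[1+n]*nCk n (suc k)) ⟩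
      suc n C suc k + suc n * (n C k) + suc n * (n C suc k)
        ≡⟨ regroup′ (suc n C suc k) (n C k) (n C suc k) n ⟩
      suc n C suc k + suc n * (n C k + n C suc k)
        ≡⟨ cong (λ x → suc n C suc k + suc n * x) ([1+n]C[1+k]≡nCk+nC[1+k] n k) ⟨
      suc (suc n) * (suc n C suc k) ∎
    where
    open ≡-Reasoning
    regroup : ∀ a b k → suc (suc k) * (a + b) ≡ a + suc k * a + suc (suc k) * b
    regroup = solve-∀
    regroup′ : ∀ a x y n → a + suc n * x + suc n * y ≡ a + suc n * (x + y)
    regroup′ = solve-∀

  k*C≡[2z+k+1]*Cpred : ∀ z k → k * (twice (z + k) C k) ≡ (2 * z + k + 1) * Cpred (twice (z + k)) k
  k*C≡[2z+k+1]*Cpred z zero    = sym (*-zeroʳ (2 * z + 0 + 1))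
  k*C≡[2z+k+1]*Cpred z (suc k) = +-cancelʳ-≡ (suc k * (n C k)) _ _ (begin
      suc k * (n C suc k) + suc k * (n C k)
        ≡⟨ *-distribˡ-+ (suc k) (n C suc k) (n C k) ⟨
      suc k * (n C suc k + n C k)
        ≡⟨ cong (suc k *_) (trans (+-comm (n C suc k) (n C k)) (sym ([1+n]C[1+k]≡nCk+nC[1+k] n k))) ⟩
      suc k * (suc n C suc k)
        ≡⟨ [1+k]*[1+n]C[1+k]≡[1+n]*nCk n k ⟩
      suc n * (n C k)
        ≡⟨ cong (λ m → suc m * (n C k)) (twice≡+ (z + suc k)) ⟩
      suc (z + suc k + (z + suc k)) * (n C k)
        ≡⟨ regroup z k (n C k) ⟩
      (2 * z + suc k + 1) * (n C k) + suc k * (n C k) ∎)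
    where
    open ≡-Reasoning
    n = twice (z + suc k)
    regroup : ∀ z k x → suc (z + suc k + (z + suc k)) * x ≡ (2 * z + suc k + 1) * x + suc k * x
    regroup = solve-∀

  ballot-closedForm : ∀ z k → ballot z (z + k) * (2 * z + k + 1) ≡ (2 * z + 1) * (twice (z + k) C k)
  ballot-closedForm z k = +-cancelʳ-≡ (c * Y) _ _ (begin
      M * c + c * Y       ≡⟨ cong (_+ c * Y) (*-comm M c) ⟩
      c * M + c * Y       ≡⟨ *-distribˡ-+ c M Y ⟨
      c * (M + Y)         ≡⟨ cong (c *_) (ballotBinomial (z + k) z k refl) ⟩
      c * X               ≡⟨ regroup z k X ⟩
      (2 * z + 1) * X + k * X ≡⟨ cong ((2 * z + 1) * X +_) (k*C≡[2z+k+1]*Cpred z k) ⟩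
      (2 * z + 1) * X + c * Y ∎)
    where
    open ≡-Reasoning
    c = 2 * z + k + 1
    M = ballot z (z + k)
    X = twice (z + k) C k
    Y = Cpred (twice (z + k)) k
    regroup : ∀ z k x → (2 * z + k + 1) * x ≡ (2 * z + 1) * x + k * x
    regroup = solve-∀

  Cat≡ballot0 : ∀ m → Cat m ≡ ballot 0 m
  Cat≡ballot0 m = begin
    ((2 * m) ℕC.C m) / suc m        ≡⟨ cong (λ n → (n ℕC.C m) / suc m) (sym (twice≡2* m)) ⟩
    (twice m ℕC.C m) / suc m        ≡⟨ cong (_/ suc m) (sym (C≡ℕC (twice m) m)) ⟩
    (twice m C m) / suc m           ≡⟨ cong (_/ suc m) (sym (trans (ballot-closedForm 0 m) (*-identityˡ _))) ⟩
    (ballot 0 m * (m + 1)) / suc m  ≡⟨ cong (λ x → (ballot 0 m * x) / suc m) (+-comm m 1) ⟩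
    (ballot 0 m * suc m) / suc m    ≡⟨ m*n/n≡m (ballot 0 m) (suc m) ⟩
    ballot 0 m                      ∎
    where open ≡-Reasoning

  ballot1≡3C/ : ∀ k → let n = 3 + k in ballot 1 (2 + k) ≡ (3 * ((2 * n ∸ 2) ℕC.C n)) / suc n
  ballot1≡3C/ k = begin
      ballot 1 (2 + k)
        ≡⟨ m*n/n≡m (ballot 1 (2 + k)) (4 + k) ⟨
      (ballot 1 (2 + k) * (4 + k)) / (4 + k)
        ≡⟨ cong (λ x → (ballot 1 (2 + k) * x) / (4 + k)) (+-comm 1 (3 + k)) ⟩
      (ballot 1 (2 + k) * (3 + k + 1)) / (4 + k)
        ≡⟨ cong (_/ (4 + k)) (ballot-closedForm 1 (1 + k)) ⟩
      (3 * (twice (2 + k) C (1 + k))) / (4 + k)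
        ≡⟨ cong (λ x → (3 * x) / (4 + k)) (twice[1+L]C[2+L]≡C[L] (1 + k)) ⟨
      (3 * (twice (2 + k) C (3 + k))) / (4 + k)
        ≡⟨ cong (λ x → (3 * x) / (4 + k)) (C≡ℕC (twice (2 + k)) (3 + k)) ⟩
      (3 * (twice (2 + k) ℕC.C (3 + k))) / (4 + k)
        ≡⟨ cong (λ m → (3 * (m ℕC.C (3 + k))) / (4 + k)) twice≡2*[3+k]∸2 ⟩
      (3 * ((2 * (3 + k) ∸ 2) ℕC.C (3 + k))) / (4 + k) ∎
    where
    open ≡-Reasoning
    twice≡2*[3+k]∸2 : twice (2 + k) ≡ 2 * (3 + k) ∸ 2
    twice≡2*[3+k]∸2 = trans (twice≡2* (2 + k)) (sym (trans (cong (_∸ 2) (*-suc 2 (2 + k))) (m+n∸m≡n 2 (2 * (2 + k)))))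

module TwoRowWalks where

  open import Data.Nat
  open import Data.Nat.Properties
  open import Data.Bool using (Bool; true; false)
  open import Relation.Nullary using (yes; no)
  open import Relation.Binary.PropositionalEquality
  open import Data.Nat.Tactic.RingSolver
  open Prelude
  open import Function using (_∘′_)
  open Ballot using (walks)

  canTop : ℕ → ℕ
  canTop zero    = 0
  canTop (suc _) = 1

  canBottom : ℕ → ℕ → ℕ
  canBottom p zero    = 0
  canBottom p (suc q) = b2n (p ≤ᵇ suc q)

  gridWalks : ℕ → ℕ → ℕ → ℕ → ℕ → ℕ
  gridWalks p q t u zero    = δ p t * δ q u
  gridWalks p q t u (suc M) =
    (canTop p + canBottom p q) * gridWalks p q t u M + canTop p * gridWalks (pred p) q t u M
    + canBottom p q * gridWalks p (pred q) t u M

  δ-*-subst : ∀ p t (f : ℕ → ℕ) → δ p t * f p ≡ δ p t * f t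
  δ-*-subst zero    zero    f = refl
  δ-*-subst zero    (suc t) f = refl
  δ-*-subst (suc p) zero    f = refl
  δ-*-subst (suc p) (suc t) f = δ-*-subst p t (f ∘′ suc)

  δδ-*-subst : ∀ p t q u (g : ℕ → ℕ → ℕ) → g p q * (δ p t * δ q u) ≡ g t u * (δ p t * δ q u)
  δδ-*-subst p t q u g = begin
      g p q * (δ p t * δ q u) ≡⟨ regroup (g p q) (δ p t) (δ q u) ⟩
      δ q u * (δ p t * g p q) ≡⟨ cong (δ q u *_) (δ-*-subst p t (λ x → g x q)) ⟩
      δ q u * (δ p t * g t q) ≡⟨ *-left-comm (δ q u) (δ p t) (g t q) ⟩
      δ p t * (δ q u * g t q) ≡⟨ cong (δ p t *_) (δ-*-subst q u (g t)) ⟩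
      δ p t * (δ q u * g t u) ≡⟨ regroup′ (δ p t) (δ q u) (g t u) ⟩
      g t u * (δ p t * δ q u) ∎
    where
    open ≡-Reasoning
    *-left-comm : ∀ y x a → y * (x * a) ≡ x * (y * a)
    *-left-comm = solve-∀
    regroup : ∀ a x y → a * (x * y) ≡ y * (x * a)
    regroup = solve-∀
    regroup′ : ∀ x y a → x * (y * a) ≡ a * (x * y)
    regroup′ = solve-∀

  -- The defining recursion removes the first step; this removes the last one.
  gridWalks-suc-last : ∀ M p q t u → gridWalks p q t u (suc M) ≡
    (canTop t + canBottom t u) * gridWalks p q t u M + gridWalks p q (suc t) u M
    + canBottom t (suc u) * gridWalks p q t (suc u) M
  gridWalks-suc-last zero p q t u = begin
      (canTop p + canBottom p q) * (δ p t * δ q u) + canTop p * (δ (pred p) t * δ q u)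
      + canBottom p q * (δ p t * δ (pred q) u)
        ≡⟨ cong₂ (λ x y → x + y + canBottom p q * (δ p t * δ (pred q) u))
                 (δδ-*-subst p t q u (λ x y → canTop x + canBottom x y)) (topStep p) ⟩
      (canTop t + canBottom t u) * (δ p t * δ q u) + δ p (suc t) * δ q u
      + canBottom p q * (δ p t * δ (pred q) u)
        ≡⟨ cong ((canTop t + canBottom t u) * (δ p t * δ q u) + δ p (suc t) * δ q u +_) (bottomStep q) ⟩
      (canTop t + canBottom t u) * (δ p t * δ q u) + δ p (suc t) * δ q u
      + canBottom t (suc u) * (δ p t * δ q (suc u)) ∎
    where
    open ≡-Reasoning
    topStep : ∀ p → canTop p * (δ (pred p) t * δ q u) ≡ δ p (suc t) * δ q u
    topStep zero    = refl
    topStep (suc p) = +-identityʳ _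
    bottomStep : ∀ q → canBottom p q * (δ p t * δ (pred q) u) ≡ canBottom t (suc u) * (δ p t * δ q (suc u))
    bottomStep zero    = sym (trans (cong (canBottom t (suc u) *_) (*-zeroʳ (δ p t))) (*-zeroʳ (canBottom t (suc u))))
    bottomStep (suc q) = δδ-*-subst p t q u (λ x y → b2n (x ≤ᵇ suc y))
  gridWalks-suc-last (suc M) p q t u = begin
      (a + b) * W p q t u (suc M) + a * W (pred p) q t u (suc M) + b * W p (pred q) t u (suc M)
        ≡⟨ cong₃ (λ x y z → (a + b) * x + a * y + b * z)
                 (gridWalks-suc-last M p q t u) (gridWalks-suc-last M (pred p) q t u) (gridWalks-suc-last M p (pred q) t u) ⟩
      (a + b) * (A * P p q t u + P p q (suc t) u + c * P p q t (suc u))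
      + a * (A * P (pred p) q t u + P (pred p) q (suc t) u + c * P (pred p) q t (suc u))
      + b * (A * P p (pred q) t u + P p (pred q) (suc t) u + c * P p (pred q) t (suc u))
        ≡⟨ regroup a b A c (P p q t u) (P p q (suc t) u) (P p q t (suc u))
                   (P (pred p) q t u) (P (pred p) q (suc t) u) (P (pred p) q t (suc u))
                   (P p (pred q) t u) (P p (pred q) (suc t) u) (P p (pred q) t (suc u)) ⟩
      A * W p q t u (suc M) + W p q (suc t) u (suc M) + c * W p q t (suc u) (suc M) ∎
    where
    open ≡-Reasoning
    W = gridWalks
    a = canTop p
    b = canBottom p q
    A = canTop t + canBottom t u
    c = canBottom t (suc u)
    P : ℕ → ℕ → ℕ → ℕ → ℕ
    P x y z w = gridWalks x y z w M
    regroup : ∀ a b A c p₀₀ p₀₁ p₀₂ p₁₀ p₁₁ p₁₂ p₂₀ p₂₁ p₂₂ →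
      (a + b) * (A * p₀₀ + p₀₁ + c * p₀₂) + a * (A * p₁₀ + p₁₁ + c * p₁₂) + b * (A * p₂₀ + p₂₁ + c * p₂₂)
      ≡ A * ((a + b) * p₀₀ + a * p₁₀ + b * p₂₀) + ((a + b) * p₀₁ + a * p₁₁ + b * p₂₁)
        + c * ((a + b) * p₀₂ + a * p₁₂ + b * p₂₂)
    regroup = solve-∀

  sumBelow-linear : ∀ B A c (f g h : ℕ → ℕ) →
    sumBelow B (λ b → A * f b + g b + c * h b) ≡ A * sumBelow B f + sumBelow B g + c * sumBelow B h
  sumBelow-linear zero    A c f g h = sym (regroup A c)
    where
    regroup : ∀ A c → A * 0 + 0 + c * 0 ≡ 0
    regroup = solve-∀
  sumBelow-linear (suc B) A c f g h =
    trans (cong (A * f 0 + g 0 + c * h 0 +_) (sumBelow-linear B A c (f ∘′ suc) (g ∘′ suc) (h ∘′ suc)))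
          (regroup A c (f 0) (g 0) (h 0) (sumBelow B (f ∘′ suc)) (sumBelow B (g ∘′ suc)) (sumBelow B (h ∘′ suc)))
    where
    regroup : ∀ A c f₀ g₀ h₀ F G H →
      A * f₀ + g₀ + c * h₀ + (A * F + G + c * H) ≡ A * (f₀ + F) + (g₀ + G) + c * (h₀ + H)
    regroup = solve-∀

  gridTotal : ℕ → ℕ → ℕ → ℕ → ℕ
  gridTotal B t u M = sumBelow B (λ b → gridWalks (suc b) b t u M)

  gridTotal-suc-last : ∀ B t u M → gridTotal B t u (suc M) ≡
    (canTop t + canBottom t u) * gridTotal B t u M + gridTotal B (suc t) u M
    + canBottom t (suc u) * gridTotal B t (suc u) M
  gridTotal-suc-last B t u M =
    trans (sumBelow-cong B (λ b → gridWalks-suc-last M (suc b) b t u))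
          (sumBelow-linear B (canTop t + canBottom t u) (canBottom t (suc u)) _ _ _)

  gridTotal-unreachable : ∀ M B t u → suc u < t → gridTotal B t u M ≡ 0
  gridTotal-unreachable zero B t u u+1<t = sumBelow-zero B atEnd
    where
    atEnd : ∀ b → δ (suc b) t * δ b u ≡ 0
    atEnd b with b ≟ u
    ... | yes refl = cong (_* δ b u) (δ-≢ (<⇒≢ u+1<t))
    ... | no b≢u   = trans (cong (δ (suc b) t *_) (δ-≢ b≢u)) (*-zeroʳ (δ (suc b) t))
  gridTotal-unreachable (suc M) B t u u+1<t = begin
      gridTotal B t u (suc M)
        ≡⟨ gridTotal-suc-last B t u M ⟩
      (canTop t + canBottom t u) * gridTotal B t u M + gridTotal B (suc t) u M
      + b2n (t ≤ᵇ suc u) * gridTotal B t (suc u) M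
        ≡⟨ cong₃ (λ x y z → (canTop t + canBottom t u) * x + y + b2n z * gridTotal B t (suc u) M)
                 (gridTotal-unreachable M B t u u+1<t) (gridTotal-unreachable M B (suc t) u (m<n⇒m<1+n u+1<t))
                 (>⇒≤ᵇ≡false u+1<t) ⟩
      (canTop t + canBottom t u) * 0 + 0 + 0 * gridTotal B t (suc u) M
        ≡⟨ regroup (canTop t + canBottom t u) (gridTotal B t (suc u) M) ⟩
      0 ∎
    where
    open ≡-Reasoning
    regroup : ∀ a x → a * 0 + 0 + 0 * x ≡ 0
    regroup = solve-∀

  positive : ℕ → Bool
  positive zero    = false
  positive (suc _) = true

  canTop≡b2n-positive : ∀ t → canTop t ≡ b2n (positive t)
  canTop≡b2n-positive zero    = refl
  canTop≡b2n-positive (suc t) = refl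

  canBottom-[1+u]-u : ∀ u → canBottom (suc u) u ≡ 0
  canBottom-[1+u]-u zero    = refl
  canBottom-[1+u]-u (suc u) = cong b2n (>⇒≤ᵇ≡false (n<1+n (suc u)))

  canBottom-≤ : ∀ {t u} → t ≤ u → canBottom t u ≡ b2n (positive u)
  canBottom-≤ {t} {zero}  _   = refl
  canBottom-≤ {t} {suc u} t≤u = cong b2n (≤⇒≤ᵇ≡true t≤u)

  δ≡walks-zero : ∀ t z {w} → t + z ≡ w → ∀ p q → δ w t ≡ walks z p q 0
  δ≡walks-zero zero    zero    refl p q = refl
  δ≡walks-zero zero    (suc z) refl p q = refl
  δ≡walks-zero (suc t) z {suc w} eq p q = δ≡walks-zero t z (suc-injective eq) p q

  -- Summing over the starting points (b + 1, b) leaves a walk in the single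
  -- coordinate z = u + 1 - t, the gap between the two rows.
  gridTotal≡walks : ∀ M B t u z → t + z ≡ suc u → u + M < B →
    gridTotal B t u M ≡ walks z (positive t) (positive u) M
  gridTotal≡walks zero B t u z eq u<B = begin
      sumBelow B (λ b → δ (suc b) t * δ b u) ≡⟨ sumBelow-cong B (λ b → *-comm (δ (suc b) t) (δ b u)) ⟩
      sumBelow B (λ b → δ b u * δ (suc b) t) ≡⟨ sumBelow-δ B u (λ b → δ (suc b) t) (subst (_< B) (+-identityʳ u) u<B) ⟩
      δ (suc u) t                             ≡⟨ δ≡walks-zero t z eq (positive t) (positive u) ⟩
      walks z (positive t) (positive u) 0     ∎
    where open ≡-Reasoning
  gridTotal≡walks (suc M) B t u zero eq u+M<B with trans (sym (+-identityʳ t)) eq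
  ... | refl = begin
      gridTotal B (suc u) u (suc M)
        ≡⟨ gridTotal-suc-last B (suc u) u M ⟩
      (1 + canBottom (suc u) u) * gridTotal B (suc u) u M + gridTotal B (suc (suc u)) u M
      + b2n (suc u ≤ᵇ suc u) * gridTotal B (suc u) (suc u) M
        ≡⟨ cong₃ (λ x y z → (1 + x) * y + gridTotal B (suc (suc u)) u M + b2n z * gridTotal B (suc u) (suc u) M)
                 (canBottom-[1+u]-u u) (gridTotal≡walks M B (suc u) u 0 (+-identityʳ (suc u)) u+M<B′)
                 (≤⇒≤ᵇ≡true (≤-refl {suc u})) ⟩
      (1 + 0) * walks 0 true (positive u) M + gridTotal B (suc (suc u)) u M + 1 * gridTotal B (suc u) (suc u) M
        ≡⟨ cong₂ (λ x y → (1 + 0) * walks 0 true (positive u) M + x + 1 * y)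
                 (gridTotal-unreachable M B (suc (suc u)) u (n<1+n (suc u)))
                 (gridTotal≡walks M B (suc u) (suc u) 1 (+-comm (suc u) 1) u+1+M<B) ⟩
      (1 + 0) * walks 0 true (positive u) M + 0 + 1 * walks 1 true true M
        ≡⟨ regroup (walks 0 true (positive u) M) (walks 1 true true M) ⟩
      walks 1 true true M + 1 * walks 0 true (positive u) M ∎
    where
    open ≡-Reasoning
    u+M<B′ : u + M < B
    u+M<B′ = ≤-trans (s≤s (+-monoʳ-≤ u (n≤1+n M))) u+M<B
    u+1+M<B : suc u + M < B
    u+1+M<B = subst (_< B) (+-suc u M) u+M<B
    regroup : ∀ a b → (1 + 0) * a + 0 + 1 * b ≡ b + 1 * a
    regroup = solve-∀
  gridTotal≡walks (suc M) B t u (suc z) eq u+M<B = begin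
      gridTotal B t u (suc M)
        ≡⟨ gridTotal-suc-last B t u M ⟩
      (canTop t + canBottom t u) * gridTotal B t u M + gridTotal B (suc t) u M
      + b2n (t ≤ᵇ suc u) * gridTotal B t (suc u) M
        ≡⟨ cong₃ (λ x y w → (x + y) * gridTotal B t u M + gridTotal B (suc t) u M + b2n w * gridTotal B t (suc u) M)
                 (canTop≡b2n-positive t) (canBottom-≤ t≤u) (≤⇒≤ᵇ≡true (m≤n⇒m≤1+n t≤u)) ⟩
      s * gridTotal B t u M + gridTotal B (suc t) u M + 1 * gridTotal B t (suc u) M
        ≡⟨ cong₃ (λ x y w → s * x + y + 1 * w)
                 (gridTotal≡walks M B t u (suc z) eq u+M<B′) (gridTotal≡walks M B (suc t) u z (cong suc t+z≡u) u+M<B′)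
                 (gridTotal≡walks M B t (suc u) (suc (suc z)) (trans (+-suc t (suc z)) (cong suc eq)) u+1+M<B) ⟩
      s * walks (suc z) (positive t) (positive u) M + walks z true (positive u) M
      + 1 * walks (suc (suc z)) (positive t) true M
        ≡⟨ regroup s (walks (suc z) (positive t) (positive u) M) (walks z true (positive u) M)
                     (walks (suc (suc z)) (positive t) true M) ⟩
      walks (suc (suc z)) (positive t) true M + walks z true (positive u) M
      + s * walks (suc z) (positive t) (positive u) M ∎
    where
    open ≡-Reasoning
    s = b2n (positive t) + b2n (positive u)
    t+z≡u : t + z ≡ u
    t+z≡u = suc-injective (trans (sym (+-suc t z)) eq)
    t≤u : t ≤ u
    t≤u = subst (t ≤_) t+z≡u (m≤m+n t z)
    u+M<B′ : u + M < B
    u+M<B′ = ≤-trans (s≤s (+-monoʳ-≤ u (n≤1+n M))) u+M<B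
    u+1+M<B : suc u + M < B
    u+1+M<B = subst (_< B) (+-suc u M) u+M<B
    regroup : ∀ A a b c → A * a + b + 1 * c ≡ c + b + A * a
    regroup = solve-∀

  gridWalks-tooShort : ∀ M p q → M < p + q → gridWalks p q 0 0 M ≡ 0
  gridWalks-tooShort zero    (suc p) q       _ = refl
  gridWalks-tooShort zero    zero    (suc q) _ = refl
  gridWalks-tooShort (suc M) p       q       M<p+q =
    trans (cong₃ (λ x y z → (canTop p + canBottom p q) * x + canTop p * y + canBottom p q * z)
                 (gridWalks-tooShort M p q (<-trans (n<1+n M) M<p+q))
                 (gridWalks-tooShort M (pred p) q M<p′+q)
                 (gridWalks-tooShort M p (pred q) M<p+q′))
          (regroup (canTop p + canBottom p q) (canTop p) (canBottom p q))
    where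
    regroup : ∀ x y z → x * 0 + y * 0 + z * 0 ≡ 0
    regroup = solve-∀
    ≤suc-pred : ∀ x → x ≤ suc (pred x)
    ≤suc-pred zero    = z≤n
    ≤suc-pred (suc x) = ≤-refl
    M<p′+q : M < pred p + q
    M<p′+q = +-cancelˡ-< 1 M (pred p + q) (<-≤-trans M<p+q (+-monoˡ-≤ q (≤suc-pred p)))
    M<p+q′ : M < p + pred q
    M<p+q′ = +-cancelˡ-< 1 M (p + pred q)
               (<-≤-trans M<p+q (subst (p + q ≤_) (+-suc p (pred q)) (+-monoʳ-≤ p (≤suc-pred q))))

  gridWalks-[1+b]-b-suc : ∀ b M → gridWalks (suc b) b 0 0 (suc M) ≡ gridWalks (suc b) b 0 0 M + gridWalks b b 0 0 M
  gridWalks-[1+b]-b-suc b M =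
    trans (cong (λ x → (1 + x) * W₀ + 1 * W₁ + x * gridWalks (suc b) (pred b) 0 0 M) (canBottom-[1+u]-u b))
          (regroup W₀ W₁ (gridWalks (suc b) (pred b) 0 0 M))
    where
    W₀ = gridWalks (suc b) b 0 0 M
    W₁ = gridWalks b b 0 0 M
    regroup : ∀ x y z → (1 + 0) * x + 1 * y + 0 * z ≡ x + y
    regroup = solve-∀

module Enumeration where

  open import Data.Nat
  open import Data.Nat.Properties
  open import Data.Bool using (Bool; true; false)
  open import Data.List using (List; []; _∷_; _++_; map; concatMap; length; filter)
  open import Data.Fin using (Fin) renaming (zero to fzero; suc to fsuc)
  open import Data.Fin.Properties using (¬Fin0)
  open import Data.Vec using (_∷_)
  open import Data.Fin.Subset using (Subset)
  open import Data.Product using (∃; _,_; proj₁)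
  open import Relation.Binary.PropositionalEquality
  open import Relation.Nullary using (Dec; does; contradiction)
  open import Algebra.Properties.CommutativeMonoid.Sum +-0-commutativeMonoid using (sum-syntax; sum-cong-≗)
  open import Defs using (allFuns; allSubsets; consFun)
  open Prelude
  open import Algebra.Properties.CommutativeSemigroup +-commutativeSemigroup using (interchange)
  open import Function using (_∘_; _∘′_)

  listSum : {A : Set} → (A → ℕ) → List A → ℕ
  listSum f []       = 0
  listSum f (x ∷ xs) = f x + listSum f xs

  countTrue : {A : Set} → (A → Bool) → List A → ℕ
  countTrue p = listSum (b2n ∘′ p)

  module _ {A : Set} where

    listSum-cong : ∀ {f g : A → ℕ} xs → (∀ x → f x ≡ g x) → listSum f xs ≡ listSum g xs
    listSum-cong []       f≗g = refl
    listSum-cong (x ∷ xs) f≗g = cong₂ _+_ (f≗g x) (listSum-cong xs f≗g)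

    listSum-zero : ∀ {f : A → ℕ} xs → (∀ x → f x ≡ 0) → listSum f xs ≡ 0
    listSum-zero []       f≗0 = refl
    listSum-zero (x ∷ xs) f≗0 = cong₂ _+_ (f≗0 x) (listSum-zero xs f≗0)

    listSum-++ : ∀ (f : A → ℕ) xs ys → listSum f (xs ++ ys) ≡ listSum f xs + listSum f ys
    listSum-++ f []       ys = refl
    listSum-++ f (x ∷ xs) ys = trans (cong (f x +_) (listSum-++ f xs ys)) (sym (+-assoc (f x) _ _))

    listSum-+ : ∀ (f g : A → ℕ) xs → listSum (λ x → f x + g x) xs ≡ listSum f xs + listSum g xs
    listSum-+ f g []       = refl
    listSum-+ f g (x ∷ xs) = trans (cong (f x + g x +_) (listSum-+ f g xs)) (interchange (f x) (g x) _ _)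

    listSum-*ˡ : ∀ k (f : A → ℕ) xs → listSum (λ x → k * f x) xs ≡ k * listSum f xs
    listSum-*ˡ k f []       = sym (*-zeroʳ k)
    listSum-*ˡ k f (x ∷ xs) = trans (cong (k * f x +_) (listSum-*ˡ k f xs)) (sym (*-distribˡ-+ k (f x) _))

    length-filter : ∀ {P : A → Set} (P? : ∀ x → Dec (P x)) xs → length (filter P? xs) ≡ countTrue (does ∘ P?) xs
    length-filter P? []       = refl
    length-filter P? (x ∷ xs) with does (P? x)
    ... | true  = cong suc (length-filter P? xs)
    ... | false = length-filter P? xs

  module _ {A B : Set} where

    listSum-map : ∀ (f : B → ℕ) (g : A → B) xs → listSum f (map g xs) ≡ listSum (f ∘′ g) xs
    listSum-map f g []       = refl
    listSum-map f g (x ∷ xs) = cong (f (g x) +_) (listSum-map f g xs)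

    listSum-concatMap : ∀ (f : B → ℕ) (g : A → List B) xs →
      listSum f (concatMap g xs) ≡ listSum (λ x → listSum f (g x)) xs
    listSum-concatMap f g []       = refl
    listSum-concatMap f g (x ∷ xs) =
      trans (listSum-++ f (g x) (concatMap g xs)) (cong (listSum f (g x) +_) (listSum-concatMap f g xs))

    listSum-swap : ∀ (f : A → B → ℕ) xs ys →
      listSum (λ x → listSum (f x) ys) xs ≡ listSum (λ y → listSum (λ x → f x y) xs) ys
    listSum-swap f []       ys = sym (listSum-zero ys (λ _ → refl))
    listSum-swap f (x ∷ xs) ys =
      trans (cong (listSum (f x) ys +_) (listSum-swap f xs ys)) (sym (listSum-+ (f x) (λ y → listSum (λ x → f x y) xs) ys))

  countTrue-positive : {A : Set} (p : A → Bool) (xs : List A) → 0 < countTrue p xs → ∃ λ x → p x ≡ true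
  countTrue-positive p (x ∷ xs) 0<n with p x in eq
  ... | true  = x , eq
  ... | false = countTrue-positive p xs 0<n

  -- Stands in for function extensionality.
  Extensional : {N : ℕ} {A B : Set} → ((Fin N → A) → B) → Set
  Extensional f = ∀ g h → (∀ c → g c ≡ h c) → f g ≡ f h

  consFun-cong : {N : ℕ} {A : Set} (x : A) {g h : Fin N → A} → (∀ c → g c ≡ h c) → ∀ c → consFun x g c ≡ consFun x h c
  consFun-cong x g≗h fzero    = refl
  consFun-cong x g≗h (fsuc c) = g≗h c

  bools : List Bool
  bools = false ∷ true ∷ []

  -- Adds the element 0 (shifting the others up) to the cells selected by h.
  _⊕_ : {N M : ℕ} → (Fin N → Bool) → (Fin N → Subset M) → Fin N → Subset (suc M)
  (h ⊕ T) c = h c ∷ T c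

  countTrue-allFuns-⊕ : ∀ N M (p : (Fin N → Subset (suc M)) → Bool) → Extensional p →
    countTrue p (allFuns (allSubsets (suc M)) N)
    ≡ listSum (λ h → countTrue (λ T → p (h ⊕ T)) (allFuns (allSubsets M) N)) (allFuns bools N)
  countTrue-allFuns-⊕ zero    M p p-ext = trans (cong (λ x → b2n x + 0) (p-ext _ _ (λ ()))) (sym (+-identityʳ _))
  countTrue-allFuns-⊕ (suc N) M p p-ext = begin
      countTrue p (concatMap (λ X → map (consFun X) F) L)
        ≡⟨ listSum-concatMap _ _ L ⟩
      listSum (λ X → countTrue p (map (consFun X) F)) L
        ≡⟨ listSum-cong L (λ X → listSum-map _ (consFun X) F) ⟩
      listSum (λ X → countTrue (p ∘′ consFun X) F) L
        ≡⟨ listSum-cong L (λ X → countTrue-allFuns-⊕ N M (p ∘′ consFun X) (λ g h g≗h → p-ext _ _ (consFun-cong X g≗h))) ⟩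
      listSum (λ X → G X) L
        ≡⟨ listSum-concatMap G (λ x → map (x ∷_) L₀) bools ⟩
      listSum (λ x → listSum G (map (x ∷_) L₀)) bools
        ≡⟨ listSum-cong bools (λ x → listSum-map G (x ∷_) L₀) ⟩
      listSum (λ x → listSum (λ Y → listSum (λ h → countTrue (λ T → p (consFun (x ∷ Y) (h ⊕ T))) F₀) H) L₀) bools
        ≡⟨ listSum-cong bools (λ x → listSum-swap (λ Y h → countTrue (λ T → p (consFun (x ∷ Y) (h ⊕ T))) F₀) L₀ H) ⟩
      listSum (λ x → listSum (λ h → listSum (λ Y → countTrue (λ T → p (consFun (x ∷ Y) (h ⊕ T))) F₀) L₀) H) bools
        ≡⟨ listSum-cong bools (λ x → listSum-cong H (λ h → listSum-cong L₀ (λ Y → listSum-cong F₀ (λ T →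
             cong b2n (p-ext _ _ (consFun-⊕ x h Y T)))))) ⟩
      listSum (λ x → listSum (λ h → listSum (λ Y → countTrue (λ T → p (consFun x h ⊕ consFun Y T)) F₀) L₀) H) bools
        ≡⟨ listSum-cong bools (λ x → listSum-cong H (λ h → sym (
             trans (listSum-concatMap (λ T → b2n (p (consFun x h ⊕ T))) (λ Y → map (consFun Y) F₀) L₀)
                   (listSum-cong L₀ (λ Y → listSum-map (λ T → b2n (p (consFun x h ⊕ T))) (consFun Y) F₀))))) ⟩
      listSum (λ x → listSum (λ h → countTrue (λ T → p (consFun x h ⊕ T)) (allFuns L₀ (suc N))) H) bools
        ≡⟨ listSum-cong bools (λ x → sym (listSum-map (λ h → countTrue (λ T → p (h ⊕ T)) (allFuns L₀ (suc N))) (consFun x) H)) ⟩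
      listSum (λ x → listSum (λ h → countTrue (λ T → p (h ⊕ T)) (allFuns L₀ (suc N))) (map (consFun x) H)) bools
        ≡⟨ listSum-concatMap (λ h → countTrue (λ T → p (h ⊕ T)) (allFuns L₀ (suc N))) (λ x → map (consFun x) H) bools ⟨
      listSum (λ h → countTrue (λ T → p (h ⊕ T)) (allFuns L₀ (suc N))) (allFuns bools (suc N)) ∎
    where
    open ≡-Reasoning
    L  = allSubsets (suc M)
    L₀ = allSubsets M
    F  = allFuns L N
    F₀ = allFuns L₀ N
    H  = allFuns bools N
    G : Subset (suc M) → ℕ
    G X = listSum (λ h → countTrue (λ T → p (consFun X (h ⊕ T))) F₀) H
    consFun-⊕ : ∀ x h Y T c → consFun (x ∷ Y) (h ⊕ T) c ≡ (consFun x h ⊕ consFun Y T) c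
    consFun-⊕ x h Y T fzero    = refl
    consFun-⊕ x h Y T (fsuc c) = refl

  singleton : ∀ {n} → Fin n → Fin n → Bool
  singleton fzero    fzero    = true
  singleton fzero    (fsuc _) = false
  singleton (fsuc c) fzero    = false
  singleton (fsuc c) (fsuc d) = singleton c d

  singleton-refl : ∀ {n} (c : Fin n) → singleton c c ≡ true
  singleton-refl fzero    = refl
  singleton-refl (fsuc c) = singleton-refl c

  singleton-true : ∀ {n} (c d : Fin n) → singleton c d ≡ true → d ≡ c
  singleton-true fzero    fzero    _  = refl
  singleton-true (fsuc c) (fsuc d) eq = cong fsuc (singleton-true c d eq)

  singleton-false : ∀ {n} (c d : Fin n) → d ≢ c → singleton c d ≡ false
  singleton-false c d d≢c with singleton c d in eq
  ... | false = refl
  ... | true  = contradiction (singleton-true c d eq) d≢c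

  listSum-allFuns-suc : ∀ N (f : (Fin (suc N) → Bool) → ℕ) →
    listSum f (allFuns bools (suc N))
    ≡ listSum (f ∘′ consFun false) (allFuns bools N) + (listSum (f ∘′ consFun true) (allFuns bools N) + 0)
  listSum-allFuns-suc N f =
    trans (listSum-concatMap f (λ x → map (consFun x) (allFuns bools N)) bools)
          (cong₂ _+_ (listSum-map f (consFun false) (allFuns bools N))
                     (cong (_+ 0) (listSum-map f (consFun true) (allFuns bools N))))

  listSum-allFuns-onlyEmpty : ∀ N (f : (Fin N → Bool) → ℕ) → Extensional f →
    (∀ h → 0 < f h → ∀ d → h d ≡ false) → listSum f (allFuns bools N) ≡ f (λ _ → false)
  listSum-allFuns-onlyEmpty zero    f f-ext supp = trans (+-identityʳ _) (f-ext _ _ (λ ()))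
  listSum-allFuns-onlyEmpty (suc N) f f-ext supp = begin
      listSum f (allFuns bools (suc N))
        ≡⟨ listSum-allFuns-suc N f ⟩
      listSum (f ∘′ consFun false) H + (listSum (f ∘′ consFun true) H + 0)
        ≡⟨ cong₂ (λ a b → a + (b + 0))
                 (listSum-allFuns-onlyEmpty N (f ∘′ consFun false) (λ g h g≗h → f-ext _ _ (consFun-cong false g≗h))
                                            (λ h 0<f d → supp _ 0<f (fsuc d)))
                 (listSum-zero H vanish) ⟩
      f (consFun false (λ _ → false)) + (0 + 0)
        ≡⟨ +-identityʳ _ ⟩
      f (consFun false (λ _ → false))
        ≡⟨ f-ext _ _ (λ { fzero → refl ; (fsuc c) → refl }) ⟩
      f (λ _ → false) ∎
    where
    open ≡-Reasoning
    H = allFuns bools N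
    vanish : ∀ h → f (consFun true h) ≡ 0
    vanish h = n≤0⇒n≡0 (≮⇒≥ (λ 0<f → contradiction (supp _ 0<f fzero) λ ()))

  listSum-allFuns-singletons : ∀ N (f : (Fin N → Bool) → ℕ) → Extensional f →
    (∀ h → 0 < f h → ∃ λ c → ∀ d → h d ≡ singleton c d) → listSum f (allFuns bools N) ≡ ∑[ c < N ] f (singleton c)
  listSum-allFuns-singletons zero f f-ext supp =
    trans (+-identityʳ _) (n≤0⇒n≡0 (≮⇒≥ (λ 0<f → ¬Fin0 (proj₁ (supp _ 0<f)))))
  listSum-allFuns-singletons (suc N) f f-ext supp = begin
      listSum f (allFuns bools (suc N))
        ≡⟨ listSum-allFuns-suc N f ⟩
      listSum (f ∘′ consFun false) H + (listSum (f ∘′ consFun true) H + 0)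
        ≡⟨ cong₂ (λ a b → a + (b + 0))
                 (listSum-allFuns-singletons N (f ∘′ consFun false) (λ g h g≗h → f-ext _ _ (consFun-cong false g≗h)) suppF)
                 (listSum-allFuns-onlyEmpty N (f ∘′ consFun true) (λ g h g≗h → f-ext _ _ (consFun-cong true g≗h)) suppT) ⟩
      ∑[ c < N ] f (consFun false (singleton c)) + (f (consFun true (λ _ → false)) + 0)
        ≡⟨ cong₂ (λ a b → a + (b + 0)) (sum-cong-≗ (λ c → f-ext (consFun false (singleton c)) (singleton (fsuc c)) (λ { fzero → refl ; (fsuc d) → refl })))
                                       (f-ext (consFun true (λ _ → false)) (singleton fzero) (λ { fzero → refl ; (fsuc d) → refl })) ⟩
      ∑[ c < N ] f (singleton (fsuc c)) + (f (singleton fzero) + 0)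
        ≡⟨ cong (∑[ c < N ] f (singleton (fsuc c)) +_) (+-identityʳ _) ⟩
      ∑[ c < N ] f (singleton (fsuc c)) + f (singleton fzero)
        ≡⟨ +-comm _ (f (singleton fzero)) ⟩
      ∑[ c < suc N ] f (singleton c) ∎
    where
    open ≡-Reasoning
    H = allFuns bools N
    suppF : ∀ h → 0 < f (consFun false h) → ∃ λ c → ∀ d → h d ≡ singleton c d
    suppF h 0<f with supp _ 0<f
    ... | fzero  , h≗ = contradiction (h≗ fzero) λ ()
    ... | fsuc c , h≗ = c , h≗ ∘ fsuc
    suppT : ∀ h → 0 < f (consFun true h) → ∀ d → h d ≡ false
    suppT h 0<f d with supp _ 0<f
    ... | fzero  , h≗ = h≗ (fsuc d)
    ... | fsuc c , h≗ = contradiction (h≗ fzero) λ ()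

module Fillings {N : ℕ} (pos : Fin N → ℕ × ℕ) where

  open import Data.Nat using (zero; suc; _+_; _*_; s≤s; z≤n; s<s⁻¹) renaming (_<_ to _<ℕ_)
  open import Data.Bool using (Bool; true; false; if_then_else_)
  import Data.Bool.Properties as Bool
  open import Data.Fin using (_<_; _≟_) renaming (zero to fzero; suc to fsuc)
  open import Data.Fin.Properties using (all?; any?; _<?_)
  open import Data.Fin.Subset using (Subset; _∈_; _∉_)
  open import Data.Fin.Subset.Properties using (_∈?_; drop-there)
  open import Data.Vec using ([]; _∷_; here; there)
  open import Data.List using ([]; _∷_)
  open import Data.Product using (∃; _,_; proj₁)
  open import Data.Sum using (_⊎_; inj₁; inj₂; [_,_])
  open import Data.Empty using (⊥; ⊥-elim)
  open import Relation.Binary.PropositionalEquality hiding ([_])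
  open import Relation.Nullary using (Dec; yes; no; does; ¬_; ¬?; contradiction)
  open import Relation.Nullary.Decidable using (_×-dec_; _→-dec_; dec-true; dec-false; does-⇔)
  open import Function using (_∘_; mk⇔)
  open import Data.Nat.Properties using (+-0-commutativeMonoid)
  open import Algebra.Properties.CommutativeMonoid.Sum +-0-commutativeMonoid using (sum-syntax; sum-cong-≗)
  open import Defs using (NW; NW?; allFuns; allSubsets; consFun; IsSYTplus; IsSYTplus?; #SYTplus)
  open Prelude
  open Enumeration

  Increasing : ∀ {M} → (Fin N → Subset M) → Set
  Increasing S = ∀ u v → u ≢ v → NW (pos u) (pos v) → ∀ i j → i ∈ S u → j ∈ S v → i < j

  Covering : ∀ {M} → (Fin N → Subset M) → Set
  Covering {M} S = ∀ (i : Fin M) → ∃ λ c → i ∈ S c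

  Disjoint : ∀ {M} → (Fin N → Subset M) → Set
  Disjoint {M} S = ∀ (i : Fin M) c d → i ∈ S c → i ∈ S d → c ≡ d

  -- An SYT^{+k}-style filling of the shape by [M] in which the cells marked by
  -- D are finished: they must stay empty, while all other cells are nonempty.
  IsFilling : (D : Fin N → Bool) (M : ℕ) → (Fin N → Subset M) → Set
  IsFilling D M S =
    (∀ c → D c ≡ false → ∃ λ i → i ∈ S c) ×
    (∀ c → D c ≡ true → ∀ i → i ∉ S c) ×
    Covering S × Disjoint S × Increasing S

  IsFilling? : ∀ D M S → Dec (IsFilling D M S)
  IsFilling? D M S =
    all? (λ c → (D c Bool.≟ false) →-dec any? (λ i → i ∈? S c)) ×-dec
    all? (λ c → (D c Bool.≟ true) →-dec all? (λ i → ¬? (i ∈? S c))) ×-dec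
    all? (λ i → any? (λ c → i ∈? S c)) ×-dec
    all? (λ i → all? (λ c → all? (λ d → (i ∈? S c) →-dec (i ∈? S d) →-dec (c ≟ d)))) ×-dec
    all? (λ u → all? (λ v → ¬? (u ≟ v) →-dec NW? (pos u) (pos v) →-dec
      all? (λ i → all? (λ j → (i ∈? S u) →-dec (j ∈? S v) →-dec (i <? j)))))

  #fillings : (D : Fin N → Bool) → ℕ → ℕ
  #fillings D M = countTrue (does ∘ IsFilling? D M) (allFuns (allSubsets M) N)

  IsMinimalLive : (D : Fin N → Bool) → Fin N → Set
  IsMinimalLive D c = D c ≡ false × (∀ u → u ≢ c → NW (pos u) (pos c) → D u ≡ true)

  IsMinimalLive? : ∀ D c → Dec (IsMinimalLive D c)
  IsMinimalLive? D c =
    (D c Bool.≟ false) ×-dec all? (λ u → ¬? (u ≟ c) →-dec NW? (pos u) (pos c) →-dec (D u Bool.≟ true))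

  finish : (Fin N → Bool) → Fin N → Fin N → Bool
  finish D c d = if does (d ≟ c) then true else D d

  finish-same : ∀ D c → finish D c c ≡ true
  finish-same D c with c ≟ c
  ... | yes _   = refl
  ... | no c≢c = contradiction refl c≢c

  finish-other : ∀ D c d → d ≢ c → finish D c d ≡ D d
  finish-other D c d d≢c with d ≟ c
  ... | yes d≡c = contradiction d≡c d≢c
  ... | no _    = refl

  IsFilling-cong : ∀ D M {S S′} → (∀ c → S c ≡ S′ c) → IsFilling D M S → IsFilling D M S′
  IsFilling-cong D M {S} {S′} S≗S′ (live , finished , cov , disj , incr) =
    (λ c Dc → let i , i∈ = live c Dc in i , to i∈) ,
    (λ c Dc i i∈ → finished c Dc i (from i∈)) ,
    (λ i → let c , i∈ = cov i in c , to i∈) ,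
    (λ i c d i∈c i∈d → disj i c d (from i∈c) (from i∈d)) ,
    (λ u v u≢v nw i j i∈ j∈ → incr u v u≢v nw i j (from i∈) (from j∈))
    where
    to : ∀ {c i} → i ∈ S c → i ∈ S′ c
    to {c} {i} = subst (i ∈_) (S≗S′ c)
    from : ∀ {c i} → i ∈ S′ c → i ∈ S c
    from {c} {i} = subst (i ∈_) (sym (S≗S′ c))

  IsFilling-congᴰ : ∀ {D D′} M S → (∀ c → D c ≡ D′ c) → IsFilling D M S → IsFilling D′ M S
  IsFilling-congᴰ M S D≗D′ (live , finished , rest) =
    (λ c → live c ∘ trans (D≗D′ c)) , (λ c → finished c ∘ trans (D≗D′ c)) , rest

  #fillings-cong : ∀ {D D′} M → (∀ c → D c ≡ D′ c) → #fillings D M ≡ #fillings D′ M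
  #fillings-cong {D} {D′} M D≗D′ = listSum-cong (allFuns (allSubsets M) N) λ S →
    cong b2n (does-⇔ (mk⇔ (IsFilling-congᴰ M S D≗D′) (IsFilling-congᴰ M S (sym ∘ D≗D′)))
                     (IsFilling? D M S) (IsFilling? D′ M S))

  -- What singleton c ⊕ T needs from T to be a filling.
  IsFillingExcept : (D : Fin N → Bool) → Fin N → ∀ {M} → (Fin N → Subset M) → Set
  IsFillingExcept D c T =
    (∀ d → d ≢ c → D d ≡ false → ∃ λ i → i ∈ T d) ×
    (∀ d → d ≢ c → D d ≡ true → ∀ i → i ∉ T d) ×
    Covering T × Disjoint T × Increasing T

  IsFilling⇒IsFillingExcept : ∀ {D M T} c → IsFilling D M T → IsFillingExcept D c T
  IsFilling⇒IsFillingExcept c (live , finished , rest) = (λ d _ → live d) , (λ d _ → finished d) , rest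

  IsFilling-finish⇒IsFillingExcept : ∀ {D M T} c → IsFilling (finish D c) M T → IsFillingExcept D c T
  IsFilling-finish⇒IsFillingExcept {D} c (live , finished , rest) =
    (λ d d≢c → live d ∘ trans (finish-other D c d d≢c)) ,
    (λ d d≢c → finished d ∘ trans (finish-other D c d d≢c)) , rest

  zero∈⇒head : ∀ {M} {x : Bool} {xs : Subset M} → fzero ∈ (x ∷ xs) → x ≡ true
  zero∈⇒head here = refl

  head⇒zero∈ : ∀ {M} {x : Bool} {xs : Subset M} → x ≡ true → fzero ∈ (x ∷ xs)
  head⇒zero∈ refl = here

  module _ {D : Fin N → Bool} {M : ℕ} {c : Fin N} {T : Fin N → Subset M} where

    private
      0∈c : fzero ∈ (singleton c ⊕ T) c
      0∈c = head⇒zero∈ (singleton-refl c)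

      0∈⇒c : ∀ {d} → fzero ∈ (singleton c ⊕ T) d → d ≡ c
      0∈⇒c = singleton-true c _ ∘ zero∈⇒head

    ⊕-filling⇒minimalLive : IsFilling D (suc M) (singleton c ⊕ T) → IsMinimalLive D c
    ⊕-filling⇒minimalLive (live , finished , _ , _ , incr) = Dc≡false , minimal
      where
      Dc≡false : D c ≡ false
      Dc≡false with D c in eq
      ... | false = refl
      ... | true  = ⊥-elim (finished c eq fzero 0∈c)
      minimal : ∀ u → u ≢ c → NW (pos u) (pos c) → D u ≡ true
      minimal u u≢c nw with D u in eq
      ... | true  = refl
      ... | false with live u eq
      ...   | i , i∈u with () ← incr u c u≢c nw i fzero i∈u 0∈c

    ⊕-filling⇒rest : IsFilling D (suc M) (singleton c ⊕ T) → IsFilling D M T ⊎ IsFilling (finish D c) M T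
    ⊕-filling⇒rest (live , finished , cov , disj , incr) = byEmptiness (any? (λ i → i ∈? T c))
      where
      liveExceptC : ∀ d → d ≢ c → D d ≡ false → ∃ λ i → i ∈ T d
      liveExceptC d d≢c Dd with live d Dd
      ... | fzero  , 0∈d = contradiction (0∈⇒c 0∈d) d≢c
      ... | fsuc i , i∈d = i , drop-there i∈d
      finishedT : ∀ d → D d ≡ true → ∀ i → i ∉ T d
      finishedT d Dd i i∈d = finished d Dd (fsuc i) (there i∈d)
      rest : Covering T × Disjoint T × Increasing T
      rest = (λ i → let d , i∈d = cov (fsuc i) in d , drop-there i∈d) ,
             (λ i d d′ i∈d i∈d′ → disj (fsuc i) d d′ (there i∈d) (there i∈d′)) ,
             (λ u v u≢v nw i j i∈u j∈v → s<s⁻¹ (incr u v u≢v nw (fsuc i) (fsuc j) (there i∈u) (there j∈v)))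
      byEmptiness : Dec (∃ λ i → i ∈ T c) → IsFilling D M T ⊎ IsFilling (finish D c) M T
      byEmptiness (yes (i , i∈c)) = inj₁ (liveT , finishedT , rest)
        where
        liveT : ∀ d → D d ≡ false → ∃ λ i → i ∈ T d
        liveT d Dd with d ≟ c
        ... | yes refl = i , i∈c
        ... | no d≢c   = liveExceptC d d≢c Dd
      byEmptiness (no c-empty) = inj₂ (liveT , finishedT′ , rest)
        where
        liveT : ∀ d → finish D c d ≡ false → ∃ λ i → i ∈ T d
        liveT d Dd with d ≟ c
        ... | yes refl = contradiction Dd λ ()
        ... | no d≢c   = liveExceptC d d≢c Dd
        finishedT′ : ∀ d → finish D c d ≡ true → ∀ i → i ∉ T d
        finishedT′ d Dd i i∈d with d ≟ c
        ... | yes refl = c-empty (i , i∈d)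
        ... | no d≢c   = finishedT d Dd i i∈d

    ⊕-filling⇐ : IsMinimalLive D c → IsFillingExcept D c T → IsFilling D (suc M) (singleton c ⊕ T)
    ⊕-filling⇐ (Dc≡false , minimal) (liveT , finishedT , covT , disjT , incrT) = live , finished , cov , disj , incr
      where
      live : ∀ d → D d ≡ false → ∃ λ i → i ∈ (singleton c ⊕ T) d
      live d Dd with d ≟ c
      ... | yes refl = fzero , 0∈c
      ... | no d≢c   = let i , i∈d = liveT d d≢c Dd in fsuc i , there i∈d
      finished : ∀ d → D d ≡ true → ∀ i → i ∉ (singleton c ⊕ T) d
      finished d Dd fzero    0∈d with refl ← 0∈⇒c 0∈d = contradiction (trans (sym Dd) Dc≡false) λ ()
      finished d Dd (fsuc i) i∈d = finishedT d d≢c Dd i (drop-there i∈d)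
        where
        d≢c : d ≢ c
        d≢c refl = contradiction (trans (sym Dd) Dc≡false) λ ()
      cov : Covering (singleton c ⊕ T)
      cov fzero    = c , 0∈c
      cov (fsuc i) = let d , i∈d = covT i in d , there i∈d
      disj : Disjoint (singleton c ⊕ T)
      disj fzero    d d′ 0∈d 0∈d′ = trans (0∈⇒c 0∈d) (sym (0∈⇒c 0∈d′))
      disj (fsuc i) d d′ i∈d i∈d′ = disjT i d d′ (drop-there i∈d) (drop-there i∈d′)
      incr : Increasing (singleton c ⊕ T)
      incr u v u≢v nw fzero    fzero    0∈u 0∈v = contradiction (trans (0∈⇒c 0∈u) (sym (0∈⇒c 0∈v))) u≢v
      incr u v u≢v nw fzero    (fsuc j) 0∈u j∈v = s≤s z≤n
      incr u v u≢v nw (fsuc i) fzero    i∈u 0∈v with refl ← 0∈⇒c 0∈v =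
        contradiction (drop-there i∈u) (finishedT u u≢v (minimal u u≢v nw) i)
      incr u v u≢v nw (fsuc i) (fsuc j) i∈u j∈v = s≤s (incrT u v u≢v nw i j (drop-there i∈u) (drop-there j∈v))

    filling-or-finished : IsMinimalLive D c → IsFilling D M T → IsFilling (finish D c) M T → ⊥
    filling-or-finished (Dc≡false , _) (live , _) (_ , finished , _) =
      let i , i∈c = live c Dc≡false in finished c (finish-same D c) i i∈c

  ⊕-filling⇒singleton : ∀ {D M} h T → IsFilling D (suc M) (h ⊕ T) → ∃ λ c → ∀ d → h d ≡ singleton c d
  ⊕-filling⇒singleton h T (_ , _ , cov , disj , _) with cov fzero
  ... | c , 0∈c = c , h≗
    where
    h≗ : ∀ d → h d ≡ singleton c d
    h≗ d with d ≟ c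
    ... | yes refl = trans (zero∈⇒head 0∈c) (sym (singleton-refl d))
    ... | no d≢c with h d in eq
    ...   | true  = contradiction (disj fzero d c (head⇒zero∈ eq) 0∈c) d≢c
    ...   | false = sym (singleton-false c d d≢c)

  #fillings-singleton : ∀ D M c →
    countTrue (λ T → does (IsFilling? D (suc M) (singleton c ⊕ T))) (allFuns (allSubsets M) N)
    ≡ b2n (does (IsMinimalLive? D c)) * (#fillings D M + #fillings (finish D c) M)
  #fillings-singleton D M c =
    trans (listSum-cong Ts (λ T → b2n-does-×-⊎ (IsFilling? D (suc M) (singleton c ⊕ T)) (IsMinimalLive? D c)
                                              (IsFilling? D M T) (IsFilling? (finish D c) M T)
                                              (λ F → ⊕-filling⇒minimalLive F , ⊕-filling⇒rest F)
                                              (λ m → [ ⊕-filling⇐ m ∘ IsFilling⇒IsFillingExcept c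
                                                     , ⊕-filling⇐ m ∘ IsFilling-finish⇒IsFillingExcept c ])
                                              filling-or-finished))
          (trans (listSum-*ˡ (b2n (does (IsMinimalLive? D c))) _ Ts)
                 (cong (b2n (does (IsMinimalLive? D c)) *_) (listSum-+ _ _ Ts)))
    where
    Ts = allFuns (allSubsets M) N

  -- The entry 0 lies in a single cell c, necessarily minimal among the live
  -- cells; removing it leaves a filling of [M] in which c is either still live
  -- or finished.
  #fillings-suc : ∀ D M →
    #fillings D (suc M) ≡ ∑[ c < N ] (b2n (does (IsMinimalLive? D c)) * (#fillings D M + #fillings (finish D c) M))
  #fillings-suc D M = begin
      #fillings D (suc M)
        ≡⟨ countTrue-allFuns-⊕ N M (does ∘ IsFilling? D (suc M)) (λ S S′ S≗S′ → does-cong S≗S′) ⟩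
      listSum f (allFuns bools N)
        ≡⟨ listSum-allFuns-singletons N f f-ext supported ⟩
      ∑[ c < N ] f (singleton c)
        ≡⟨ sum-cong-≗ (#fillings-singleton D M) ⟩
      ∑[ c < N ] (b2n (does (IsMinimalLive? D c)) * (#fillings D M + #fillings (finish D c) M)) ∎
    where
    open ≡-Reasoning
    Ts = allFuns (allSubsets M) N
    does-cong : ∀ {S S′} → (∀ c → S c ≡ S′ c) → does (IsFilling? D (suc M) S) ≡ does (IsFilling? D (suc M) S′)
    does-cong S≗S′ = does-⇔ (mk⇔ (IsFilling-cong D (suc M) S≗S′) (IsFilling-cong D (suc M) (sym ∘ S≗S′))) (IsFilling? D (suc M) _) (IsFilling? D (suc M) _)
    f : (Fin N → Bool) → ℕ
    f h = countTrue (λ T → does (IsFilling? D (suc M) (h ⊕ T))) Ts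
    f-ext : Extensional f
    f-ext h h′ h≗h′ = listSum-cong Ts (λ T → cong b2n (does-cong (λ c → cong (_∷ T c) (h≗h′ c))))
    supported : ∀ h → 0 <ℕ f h → ∃ λ c → ∀ d → h d ≡ singleton c d
    supported h 0<f with T , isF ← countTrue-positive _ Ts 0<f =
      ⊕-filling⇒singleton h T (does≡true⇒ (IsFilling? D (suc M) (h ⊕ T)) isF)

  allFuns-singletonList : ∀ {A : Set} (x : A) n → ∃ λ f → allFuns (x ∷ []) n ≡ f ∷ []
  allFuns-singletonList x zero    = _ , refl
  allFuns-singletonList x (suc n) with f , eq ← allFuns-singletonList x n rewrite eq = consFun x f , refl

  #fillings-0-allFinished : ∀ D → (∀ c → D c ≡ true) → #fillings D 0 ≡ 1
  #fillings-0-allFinished D allFinished with S , eq ← allFuns-singletonList [] N =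
    trans (cong (countTrue (does ∘ IsFilling? D 0)) eq) (cong (λ b → b2n b + 0) (dec-true (IsFilling? D 0 S) empty))
    where
    empty : IsFilling D 0 S
    empty = (λ c Dc → contradiction (trans (sym (allFinished c)) Dc) λ ()) , (λ _ _ ()) , (λ ()) , (λ ()) , (λ _ _ _ _ ())

  #fillings-0-live : ∀ D c → D c ≡ false → #fillings D 0 ≡ 0
  #fillings-0-live D c Dc≡false with S , eq ← allFuns-singletonList [] N =
    trans (cong (countTrue (does ∘ IsFilling? D 0)) eq) (cong (λ b → b2n b + 0) (dec-false (IsFilling? D 0 S) noEntry))
    where
    noEntry : ¬ IsFilling D 0 S
    noEntry (live , _) with () ← proj₁ (live c Dc≡false)

  #SYTplus≡#fillings : ∀ k → #SYTplus N pos k ≡ #fillings (λ _ → false) (N + k)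
  #SYTplus≡#fillings k =
    trans (length-filter (IsSYTplus? pos (N + k)) Ss)
          (listSum-cong Ss (λ S → cong b2n (does-⇔ (mk⇔ to from) (IsSYTplus? pos (N + k) S) (IsFilling? _ (N + k) S))))
    where
    Ss = allFuns (allSubsets (N + k)) N
    to : ∀ {S} → IsSYTplus pos (N + k) S → IsFilling (λ _ → false) (N + k) S
    to (live , cov , disj , incr) = (λ c _ → live c) , (λ _ ()) , cov , disj , incr
    from : ∀ {S} → IsFilling (λ _ → false) (N + k) S → IsSYTplus pos (N + k) S
    from (live , _ , cov , disj , incr) = (λ c → live c refl) , cov , disj , incr

-- A top row of a cells in columns s, …, s + a - 1 over a bottom row of bb
-- cells in columns 0, …, bb - 1; the cells are numbered row by row.
module TwoRowShape (a s bb : ℕ) (a+s≡1+bb : a ℕ.+ s ≡ ℕ.suc bb) where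

  open import Data.Nat using (zero; suc; _+_; _*_; _∸_; _<ᵇ_; _≤_; _<_; s≤s; z≤n; pred; s<s⁻¹)
  open import Data.Nat.Properties
  open import Data.Bool using (Bool; true; false; if_then_else_)
  open import Data.Fin using (Fin; toℕ; fromℕ<) renaming (zero to fzero; suc to fsuc)
  open import Data.Fin.Properties using (toℕ-injective; toℕ<n; toℕ-fromℕ<)
  open import Data.Product using (_×_; _,_; proj₁; proj₂)
  open import Data.Sum using (_⊎_; inj₁; inj₂)
  open import Relation.Binary.PropositionalEquality hiding ([_])
  open import Relation.Binary.Definitions using (tri<; tri≈; tri>)
  open import Relation.Nullary using (yes; no; does; ¬_; contradiction)
  open import Function using (_∘_)
  open import Relation.Nullary.Decidable using (dec-true; dec-false)
  open import Algebra.Properties.CommutativeMonoid.Sum +-0-commutativeMonoid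
    using (sum-syntax; sum-cong-≗; ∑-distrib-+; sum-replicate-zero)
  open import Data.Nat.Tactic.RingSolver
  open import Defs using (NW; #SYTplus)
  open Prelude
  open TwoRowWalks using (canTop; canBottom; gridWalks)
  open Enumeration using (singleton)

  N : ℕ
  N = a + bb

  cellPos : ℕ → ℕ × ℕ
  cellPos m = if m <ᵇ a then (0 , m + s) else (1 , m ∸ a)

  pos : Fin N → ℕ × ℕ
  pos c = cellPos (toℕ c)

  open Fillings pos

  finishedIdx : ℕ → ℕ → ℕ → Bool
  finishedIdx i j m = if m <ᵇ a then m <ᵇ i else (m ∸ a) <ᵇ j

  finishedFirst : ℕ → ℕ → Fin N → Bool
  finishedFirst i j c = finishedIdx i j (toℕ c)

  cellPos-top : ∀ {m} → m < a → cellPos m ≡ (0 , m + s)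
  cellPos-top m<a rewrite <⇒<ᵇ≡true m<a = refl

  cellPos-bottom : ∀ {m} → a ≤ m → cellPos m ≡ (1 , m ∸ a)
  cellPos-bottom a≤m rewrite ≥⇒<ᵇ≡false a≤m = refl

  finishedIdx-top : ∀ i j {m} → m < a → finishedIdx i j m ≡ (m <ᵇ i)
  finishedIdx-top i j m<a rewrite <⇒<ᵇ≡true m<a = refl

  finishedIdx-bottom : ∀ i j {m} → a ≤ m → finishedIdx i j m ≡ ((m ∸ a) <ᵇ j)
  finishedIdx-bottom i j a≤m rewrite ≥⇒<ᵇ≡false a≤m = refl

  m<ᵇm : ∀ m → (m <ᵇ m) ≡ false
  m<ᵇm m = ≥⇒<ᵇ≡false (≤-refl {m})

  m≢i⇒m<ᵇi≡m<ᵇ1+i : ∀ {m i} → m ≢ i → (m <ᵇ i) ≡ (m <ᵇ suc i)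
  m≢i⇒m<ᵇi≡m<ᵇ1+i {m} {i} m≢i with <-cmp m i
  ... | tri< m<i _ _ = trans (<⇒<ᵇ≡true m<i) (sym (<⇒<ᵇ≡true (m<n⇒m<1+n m<i)))
  ... | tri≈ _ m≡i _ = contradiction m≡i m≢i
  ... | tri> _ _ i<m = trans (≥⇒<ᵇ≡false (<⇒≤ i<m)) (sym (≥⇒<ᵇ≡false i<m))

  m≡a+[m∸a] : ∀ {m} → a ≤ m → m ≡ a + (m ∸ a)
  m≡a+[m∸a] a≤m = sym (m+[n∸m]≡n a≤m)

  topCell : ∀ {i} → i < a → Fin N
  topCell i<a = fromℕ< (<-≤-trans i<a (m≤m+n a bb))

  toℕ-topCell : ∀ {i} (i<a : i < a) → toℕ (topCell i<a) ≡ i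
  toℕ-topCell i<a = toℕ-fromℕ< _

  bottomCell : ∀ {j} → j < bb → Fin N
  bottomCell j<bb = fromℕ< (+-monoʳ-< a j<bb)

  toℕ-bottomCell : ∀ {j} (j<bb : j < bb) → toℕ (bottomCell j<bb) ≡ a + j
  toℕ-bottomCell j<bb = toℕ-fromℕ< _

  canTop-a∸i : ∀ {i} → i < a → canTop (a ∸ i) ≡ 1
  canTop-a∸i {i} i<a with a ∸ i | m>n⇒m∸n≢0 i<a
  ... | zero  | a∸i≢0 = contradiction refl a∸i≢0
  ... | suc _ | _     = refl

  canBottom-1 : ∀ {p q} → q ≢ 0 → p ≤ q → canBottom p q ≡ 1
  canBottom-1 {p} {zero}  q≢0 _   = contradiction refl q≢0
  canBottom-1 {p} {suc q} _   p≤q = cong b2n (≤⇒≤ᵇ≡true p≤q)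

  canBottom-0 : ∀ {p q} → q < p → canBottom p q ≡ 0
  canBottom-0 {p} {zero}  _   = refl
  canBottom-0 {p} {suc q} q<p = cong b2n (>⇒≤ᵇ≡false q<p)

  a∸i+[i+s]≡1+bb : ∀ {i} → i ≤ a → (a ∸ i) + (i + s) ≡ suc bb
  a∸i+[i+s]≡1+bb {i} i≤a = trans (sym (+-assoc (a ∸ i) i s)) (trans (cong (_+ s) (m∸n+n≡m i≤a)) a+s≡1+bb)

  -- Bottom cell j has no live cell north-west of it exactly when j < i + s.
  canBottom-open : ∀ {i j} → i ≤ a → j < bb → suc j ≤ i + s → canBottom (a ∸ i) (bb ∸ j) ≡ 1
  canBottom-open {i} {j} i≤a j<bb j<i+s = canBottom-1 (m>n⇒m∸n≢0 j<bb) (+-cancelʳ-≤ (i + s) (a ∸ i) (bb ∸ j) ≤)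
    where
    ≤ : (a ∸ i) + (i + s) ≤ (bb ∸ j) + (i + s)
    ≤ = subst (_≤ (bb ∸ j) + (i + s)) (sym (a∸i+[i+s]≡1+bb i≤a))
          (subst (_≤ (bb ∸ j) + (i + s)) (trans (+-suc (bb ∸ j) j) (cong suc (m∸n+n≡m (<⇒≤ j<bb))))
                 (+-monoʳ-≤ (bb ∸ j) j<i+s))

  canBottom-blocked : ∀ {i j} → i ≤ a → j < bb → i + s ≤ j → canBottom (a ∸ i) (bb ∸ j) ≡ 0
  canBottom-blocked {i} {j} i≤a j<bb i+s≤j = canBottom-0 (+-cancelʳ-≤ (i + s) (suc (bb ∸ j)) (a ∸ i) ≤)
    where
    ≤ : suc (bb ∸ j) + (i + s) ≤ (a ∸ i) + (i + s)
    ≤ = subst (suc (bb ∸ j) + (i + s) ≤_) (sym (a∸i+[i+s]≡1+bb i≤a))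
          (subst (suc (bb ∸ j) + (i + s) ≤_) (cong suc (m∸n+n≡m (<⇒≤ j<bb))) (s≤s (+-monoʳ-≤ (bb ∸ j) i+s≤j)))

  finish-top : ∀ i j c → toℕ c ≡ i → i < a → ∀ d → finish (finishedFirst i j) c d ≡ finishedFirst (suc i) j d
  finish-top i j c c≡i i<a d with d Data.Fin.≟ c
  ... | yes refl = sym (trans (finishedIdx-top (suc i) j (subst (_< a) (sym c≡i) i<a))
                              (<⇒<ᵇ≡true (subst (_< suc i) (sym c≡i) (n<1+n i))))
  ... | no d≢c with toℕ d <? a
  ...   | yes d<a = trans (finishedIdx-top i j d<a)
                          (trans (m≢i⇒m<ᵇi≡m<ᵇ1+i (λ d≡i → d≢c (toℕ-injective (trans d≡i (sym c≡i)))))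
                                 (sym (finishedIdx-top (suc i) j d<a)))
  ...   | no d≮a  = trans (finishedIdx-bottom i j (≮⇒≥ d≮a)) (sym (finishedIdx-bottom (suc i) j (≮⇒≥ d≮a)))

  finish-bottom : ∀ i j c → toℕ c ≡ a + j → ∀ d → finish (finishedFirst i j) c d ≡ finishedFirst i (suc j) d
  finish-bottom i j c c≡a+j d with d Data.Fin.≟ c
  ... | yes refl = sym (trans (finishedIdx-bottom i (suc j) a≤c)
                              (<⇒<ᵇ≡true (subst (_< suc j) (sym (trans (cong (_∸ a) c≡a+j) (m+n∸m≡n a j))) (n<1+n j))))
    where
    a≤c : a ≤ toℕ d
    a≤c = subst (a ≤_) (sym c≡a+j) (m≤m+n a j)
  ... | no d≢c with toℕ d <? a
  ...   | yes d<a = trans (finishedIdx-top i j d<a) (sym (finishedIdx-top i (suc j) d<a))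
  ...   | no d≮a  = trans (finishedIdx-bottom i j (≮⇒≥ d≮a))
                          (trans (m≢i⇒m<ᵇi≡m<ᵇ1+i d∸a≢j) (sym (finishedIdx-bottom i (suc j) (≮⇒≥ d≮a))))
    where
    d∸a≢j : toℕ d ∸ a ≢ j
    d∸a≢j eq = d≢c (toℕ-injective (trans (m≡a+[m∸a] (≮⇒≥ d≮a)) (trans (cong (a +_) eq) (sym c≡a+j))))

  topCell-live : ∀ i j (i<a : i < a) → finishedFirst i j (topCell i<a) ≡ false
  topCell-live i j i<a = trans (cong (finishedIdx i j) (toℕ-topCell i<a)) (trans (finishedIdx-top i j i<a) (m<ᵇm i))

  pos-topCell : ∀ {i} (i<a : i < a) → pos (topCell i<a) ≡ (0 , i + s)
  pos-topCell i<a = trans (cong cellPos (toℕ-topCell i<a)) (cellPos-top i<a)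

  bottomCell-live : ∀ i j (j<bb : j < bb) → finishedFirst i j (bottomCell j<bb) ≡ false
  bottomCell-live i j j<bb = trans (cong (finishedIdx i j) (toℕ-bottomCell j<bb))
                                   (trans (finishedIdx-bottom i j (m≤m+n a j)) (trans (cong (_<ᵇ j) (m+n∸m≡n a j)) (m<ᵇm j)))

  pos-bottomCell : ∀ {j} (j<bb : j < bb) → pos (bottomCell j<bb) ≡ (1 , j)
  pos-bottomCell {j} j<bb = trans (cong cellPos (toℕ-bottomCell j<bb))
                                  (trans (cellPos-bottom (m≤m+n a j)) (cong (1 ,_) (m+n∸m≡n a j)))

  module PerCell (M i j : ℕ) (i≤a : i ≤ a) (j≤bb : j ≤ bb) where

    D = finishedFirst i j
    p = a ∸ i
    q = bb ∸ j
    Y  = #fillings D M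
    Zᵗ = #fillings (finishedFirst (suc i) j) M
    Zᵇ = #fillings (finishedFirst i (suc j)) M

    contribution : Fin N → ℕ
    contribution c = b2n (does (IsMinimalLive? D c)) * (Y + #fillings (finish D c) M)

    expected : Fin N → ℕ
    expected c = δ (toℕ c) i * (canTop p * (Y + Zᵗ)) + δ (toℕ c) (a + j) * (canBottom p q * (Y + Zᵇ))

    δ*≡0 : ∀ m k x y → δ m k * x ≡ 0 → δ m k * (x * y) ≡ 0
    δ*≡0 m k x y δx≡0 = trans (sym (*-assoc (δ m k) x y)) (cong (_* y) δx≡0)

    notMinimal : ∀ c → ¬ IsMinimalLive D c →
      δ (toℕ c) i * canTop p ≡ 0 → δ (toℕ c) (a + j) * canBottom p q ≡ 0 → contribution c ≡ expected c
    notMinimal c ¬min top≡0 bottom≡0 =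
      trans (cong (λ b → b2n b * (Y + #fillings (finish D c) M)) (dec-false (IsMinimalLive? D c) ¬min))
            (sym (cong₂ _+_ (δ*≡0 (toℕ c) i (canTop p) (Y + Zᵗ) top≡0) (δ*≡0 (toℕ c) (a + j) (canBottom p q) (Y + Zᵇ) bottom≡0)))

    minimalCell : ∀ c {Z} → IsMinimalLive D c → #fillings (finish D c) M ≡ Z → contribution c ≡ Y + Z
    minimalCell c min finish≡Z =
      trans (cong₂ (λ b z → b2n b * (Y + z)) (dec-true (IsMinimalLive? D c) min) finish≡Z) (*-identityˡ _)

    1*1*x≡x : ∀ x → 1 * (1 * x) ≡ x
    1*1*x≡x x = trans (*-identityˡ (1 * x)) (*-identityˡ x)

    finished⇒¬minimal : ∀ {c} → D c ≡ true → ¬ IsMinimalLive D c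
    finished⇒¬minimal Dc (Dc≡false , _) = contradiction (trans (sym Dc) Dc≡false) λ ()

    blocked⇒¬minimal : ∀ {c} u → toℕ u ≢ toℕ c → D u ≡ false → NW (pos u) (pos c) → ¬ IsMinimalLive D c
    blocked⇒¬minimal u u≢c Du nw (_ , minimal) =
      contradiction (trans (sym (minimal u (u≢c ∘ cong toℕ) nw)) Du) λ ()

    δ-top≡0 : ∀ {m} → a ≤ m → δ m i * canTop p ≡ 0
    δ-top≡0 {m} a≤m with m ≟ i
    ... | yes refl = trans (cong (λ x → δ m m * canTop x) (trans (cong (a ∸_) (sym (≤-antisym a≤m i≤a))) (n∸n≡0 a)))
                           (*-zeroʳ (δ m m))
    ... | no m≢i   = cong (_* canTop p) (δ-≢ m≢i)

    δ-bottom≡0 : ∀ {m} → m < a → δ m (a + j) * canBottom p q ≡ 0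
    δ-bottom≡0 m<a = cong (_* canBottom p q) (δ-≢ (<⇒≢ (<-≤-trans m<a (m≤m+n a j))))

    perCell-top : ∀ c → toℕ c < a → contribution c ≡ expected c
    perCell-top c m<a with <-cmp (toℕ c) i
    ... | tri< m<i _ _ = notMinimal c (finished⇒¬minimal (trans (finishedIdx-top i j m<a) (<⇒<ᵇ≡true m<i)))
                                    (cong (_* canTop p) (δ-≢ (<⇒≢ m<i))) (δ-bottom≡0 m<a)
    ... | tri> _ _ i<m = notMinimal c (blocked⇒¬minimal (topCell i<a) (λ eq → <⇒≢ i<m (trans (sym (toℕ-topCell i<a)) eq))
                                                          (topCell-live i j i<a) nw)
                                    (cong (_* canTop p) (δ-≢ (λ eq → <⇒≢ i<m (sym eq)))) (δ-bottom≡0 m<a)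
      where
      i<a = <-trans i<m m<a
      nw : NW (pos (topCell i<a)) (pos c)
      nw = subst₂ NW (sym (pos-topCell i<a)) (sym (cellPos-top m<a)) (z≤n , +-monoˡ-≤ s (<⇒≤ i<m))
    ... | tri≈ _ m≡i _ =
      trans (minimalCell c minimalLive (#fillings-cong M (finish-top i j c m≡i i<a)))
            (sym (trans (cong₂ _+_ (cong₂ (λ x y → x * (y * (Y + Zᵗ))) (trans (cong (δ (toℕ c)) (sym m≡i)) (δ-refl (toℕ c)))
                                                                       (canTop-a∸i i<a))
                                   (δ*≡0 (toℕ c) (a + j) (canBottom p q) (Y + Zᵇ) (δ-bottom≡0 m<a)))
                        (trans (+-identityʳ _) (1*1*x≡x (Y + Zᵗ)))))
      where
      i<a = subst (_< a) m≡i m<a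
      minimalLive : IsMinimalLive D c
      minimalLive = trans (finishedIdx-top i j m<a) (subst (λ x → (toℕ c <ᵇ x) ≡ false) m≡i (m<ᵇm (toℕ c))) , minimal
        where
        minimal : ∀ u → u ≢ c → NW (pos u) (pos c) → D u ≡ true
        minimal u u≢c nw with toℕ u <? a
        ... | yes u<a = trans (finishedIdx-top i j u<a)
                              (<⇒<ᵇ≡true (subst (toℕ u <_) m≡i (≤∧≢⇒< u≤c (u≢c ∘ toℕ-injective))))
          where
          u≤c : toℕ u ≤ toℕ c
          u≤c = +-cancelʳ-≤ s (toℕ u) (toℕ c) (proj₂ (subst₂ NW (cellPos-top u<a) (cellPos-top m<a) nw))
        ... | no u≮a with () ← proj₁ (subst₂ NW (cellPos-bottom (≮⇒≥ u≮a)) (cellPos-top m<a) nw)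

    perCell-bottom : ∀ c → a ≤ toℕ c → contribution c ≡ expected c
    perCell-bottom c a≤m with <-cmp (toℕ c ∸ a) j
    ... | tri< r<j _ _ = notMinimal c (finished⇒¬minimal (trans (finishedIdx-bottom i j a≤m) (<⇒<ᵇ≡true r<j)))
                                    (δ-top≡0 a≤m) (cong (_* canBottom p q) (δ-≢ m≢a+j))
      where
      m≢a+j : toℕ c ≢ a + j
      m≢a+j eq = <⇒≢ r<j (trans (cong (_∸ a) eq) (m+n∸m≡n a j))
    ... | tri> _ _ j<r = notMinimal c (blocked⇒¬minimal (bottomCell j<bb) (<⇒≢ a+j<m ∘ trans (sym (toℕ-bottomCell j<bb)))
                                                          (bottomCell-live i j j<bb) nw)
                                    (δ-top≡0 a≤m) (cong (_* canBottom p q) (δ-≢ (<⇒≢ a+j<m ∘ sym)))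
      where
      a+j<m : a + j < toℕ c
      a+j<m = subst (a + j <_) (sym (m≡a+[m∸a] a≤m)) (+-monoʳ-< a j<r)
      j<bb : j < bb
      j<bb = +-cancelˡ-< a j bb (<-trans a+j<m (toℕ<n c))
      nw : NW (pos (bottomCell j<bb)) (pos c)
      nw = subst₂ NW (sym (pos-bottomCell j<bb)) (sym (cellPos-bottom a≤m)) (≤-refl , <⇒≤ j<r)
    ... | tri≈ _ r≡j _ with suc j ≤? i + s
    ...   | yes j<i+s =
      trans (minimalCell c minimalLive (#fillings-cong M (finish-bottom i j c m≡a+j)))
            (sym (trans (cong₂ _+_ (δ*≡0 (toℕ c) i (canTop p) (Y + Zᵗ) (δ-top≡0 a≤m))
                                   (cong₂ (λ x y → x * (y * (Y + Zᵇ))) (trans (cong (δ (toℕ c)) (sym m≡a+j)) (δ-refl (toℕ c)))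
                                                                       (canBottom-open i≤a j<bb j<i+s)))
                        (1*1*x≡x (Y + Zᵇ))))
      where
      m≡a+j : toℕ c ≡ a + j
      m≡a+j = trans (m≡a+[m∸a] a≤m) (cong (a +_) r≡j)
      j<bb : j < bb
      j<bb = +-cancelˡ-< a j bb (subst (_< a + bb) m≡a+j (toℕ<n c))
      minimalLive : IsMinimalLive D c
      minimalLive = trans (finishedIdx-bottom i j a≤m) (subst (λ x → (x <ᵇ j) ≡ false) (sym r≡j) (m<ᵇm j)) , minimal
        where
        minimal : ∀ u → u ≢ c → NW (pos u) (pos c) → D u ≡ true
        minimal u u≢c nw with toℕ u <? a
        ... | yes u<a = trans (finishedIdx-top i j u<a) (<⇒<ᵇ≡true (+-cancelʳ-< s (toℕ u) i (<-≤-trans (s≤s u+s≤j) j<i+s)))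
          where
          u+s≤j : toℕ u + s ≤ j
          u+s≤j = subst (toℕ u + s ≤_) r≡j (proj₂ (subst₂ NW (cellPos-top u<a) (cellPos-bottom a≤m) nw))
        ... | no u≮a = trans (finishedIdx-bottom i j (≮⇒≥ u≮a)) (<⇒<ᵇ≡true (≤∧≢⇒< u∸a≤j u∸a≢j))
          where
          u∸a≤j : toℕ u ∸ a ≤ j
          u∸a≤j = subst (toℕ u ∸ a ≤_) r≡j (proj₂ (subst₂ NW (cellPos-bottom (≮⇒≥ u≮a)) (cellPos-bottom a≤m) nw))
          u∸a≢j : toℕ u ∸ a ≢ j
          u∸a≢j eq = u≢c (toℕ-injective (trans (m≡a+[m∸a] (≮⇒≥ u≮a)) (trans (cong (a +_) eq) (sym m≡a+j))))
    ...   | no j≮i+s = notMinimal c (blocked⇒¬minimal (topCell i<a) (<⇒≢ i<m ∘ trans (sym (toℕ-topCell i<a)))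
                                                        (topCell-live i j i<a) nw)
                                  (δ-top≡0 a≤m) (trans (cong (δ (toℕ c) (a + j) *_) (canBottom-blocked i≤a j<bb i+s≤j))
                                                       (*-zeroʳ (δ (toℕ c) (a + j))))
      where
      m≡a+j : toℕ c ≡ a + j
      m≡a+j = trans (m≡a+[m∸a] a≤m) (cong (a +_) r≡j)
      j<bb : j < bb
      j<bb = +-cancelˡ-< a j bb (subst (_< a + bb) m≡a+j (toℕ<n c))
      i+s≤j : i + s ≤ j
      i+s≤j = ≤-pred (≰⇒> j≮i+s)
      i<a : i < a
      i<a = +-cancelʳ-< s i a (subst (i + s <_) (sym a+s≡1+bb) (<-≤-trans (s≤s i+s≤j) (s≤s (<⇒≤ j<bb))))
      i<m : i < toℕ c
      i<m = <-≤-trans i<a a≤m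
      nw : NW (pos (topCell i<a)) (pos c)
      nw = subst₂ NW (sym (pos-topCell i<a)) (sym (cellPos-bottom a≤m)) (z≤n , subst (i + s ≤_) (sym r≡j) i+s≤j)

    perCell : ∀ c → contribution c ≡ expected c
    perCell c with toℕ c <? a
    ... | yes m<a = perCell-top c m<a
    ... | no m≮a  = perCell-bottom c (≮⇒≥ m≮a)

  ∑-δ : ∀ n k x → k < n ⊎ x ≡ 0 → ∑[ c < n ] (δ (toℕ c) k * x) ≡ x
  ∑-δ n       k       x (inj₂ refl) = trans (sum-cong-≗ {n} (λ c → *-zeroʳ (δ (toℕ c) k))) (sum-replicate-zero n)
  ∑-δ (suc n) zero    x (inj₁ _)    = trans (cong (1 * x +_) (sum-replicate-zero n)) (trans (+-identityʳ _) (*-identityˡ x))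
  ∑-δ (suc n) (suc k) x (inj₁ k<n)  = ∑-δ n k x (inj₁ (s<s⁻¹ k<n))

  #fillings-0 : ∀ i j → i ≤ a → j ≤ bb → #fillings (finishedFirst i j) 0 ≡ δ (a ∸ i) 0 * δ (bb ∸ j) 0
  #fillings-0 i j i≤a j≤bb with i <? a
  ... | yes i<a = trans (#fillings-0-live _ _ (topCell-live i j i<a))
                        (sym (cong (_* δ (bb ∸ j) 0) (δ-≢ (m>n⇒m∸n≢0 i<a))))
  ... | no i≮a with refl ← ≤-antisym i≤a (≮⇒≥ i≮a) with j <? bb
  ...   | yes j<bb = trans (#fillings-0-live _ _ (bottomCell-live a j j<bb))
                           (sym (cong₂ (λ x y → δ x 0 * y) (n∸n≡0 a) (δ-≢ (m>n⇒m∸n≢0 j<bb))))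
  ...   | no j≮bb with refl ← ≤-antisym j≤bb (≮⇒≥ j≮bb) =
    trans (#fillings-0-allFinished _ allFinished) (sym (cong₂ (λ x y → δ x 0 * δ y 0) (n∸n≡0 a) (n∸n≡0 bb)))
    where
    allFinished : ∀ c → finishedFirst a bb c ≡ true
    allFinished c with toℕ c <? a
    ... | yes c<a = trans (finishedIdx-top a bb c<a) (<⇒<ᵇ≡true c<a)
    ... | no c≮a  = trans (finishedIdx-bottom a bb (≮⇒≥ c≮a))
                          (<⇒<ᵇ≡true (+-cancelˡ-< a _ bb (subst (_< a + bb) (m≡a+[m∸a] (≮⇒≥ c≮a)) (toℕ<n c))))

  -- The walk coordinates are the numbers of unfinished cells in the two rows.
  #fillings≡gridWalks : ∀ M i j → i ≤ a → j ≤ bb → #fillings (finishedFirst i j) M ≡ gridWalks (a ∸ i) (bb ∸ j) 0 0 M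
  #fillings≡gridWalks zero    i j i≤a j≤bb = #fillings-0 i j i≤a j≤bb
  #fillings≡gridWalks (suc M) i j i≤a j≤bb = begin
      #fillings D (suc M)
        ≡⟨ #fillings-suc D M ⟩
      ∑[ c < N ] contribution c
        ≡⟨ sum-cong-≗ perCell ⟩
      ∑[ c < N ] expected c
        ≡⟨ ∑-distrib-+ {N} (λ c → δ (toℕ c) i * A) (λ c → δ (toℕ c) (a + j) * B) ⟩
      ∑[ c < N ] (δ (toℕ c) i * A) + ∑[ c < N ] (δ (toℕ c) (a + j) * B)
        ≡⟨ cong₂ _+_ (∑-δ N i A top-or-0) (∑-δ N (a + j) B bottom-or-0) ⟩
      A + B
        ≡⟨ cong₂ _+_ topStep bottomStep ⟩
      canTop p * (W + gridWalks (pred p) q 0 0 M) + canBottom p q * (W + gridWalks p (pred q) 0 0 M)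
        ≡⟨ regroup (canTop p) (canBottom p q) W (gridWalks (pred p) q 0 0 M) (gridWalks p (pred q) 0 0 M) ⟩
      gridWalks p q 0 0 (suc M) ∎
    where
    open ≡-Reasoning
    open PerCell M i j i≤a j≤bb
    A = canTop p * (Y + Zᵗ)
    B = canBottom p q * (Y + Zᵇ)
    W = gridWalks p q 0 0 M
    top-or-0 : i < N ⊎ A ≡ 0
    top-or-0 with i <? a
    ... | yes i<a = inj₁ (<-≤-trans i<a (m≤m+n a bb))
    ... | no i≮a with refl ← ≤-antisym i≤a (≮⇒≥ i≮a) = inj₂ (cong (λ x → canTop x * (Y + Zᵗ)) (n∸n≡0 a))
    bottom-or-0 : a + j < N ⊎ B ≡ 0
    bottom-or-0 with j <? bb
    ... | yes j<bb = inj₁ (+-monoʳ-< a j<bb)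
    ... | no j≮bb with refl ← ≤-antisym j≤bb (≮⇒≥ j≮bb) = inj₂ (cong (λ x → canBottom p x * (Y + Zᵇ)) (n∸n≡0 bb))
    Y≡W : Y ≡ W
    Y≡W = #fillings≡gridWalks M i j i≤a j≤bb
    topStep : A ≡ canTop p * (W + gridWalks (pred p) q 0 0 M)
    topStep with i <? a
    ... | yes i<a = cong (canTop p *_) (cong₂ _+_ Y≡W (trans (#fillings≡gridWalks M (suc i) j i<a j≤bb)
                                                            (cong (λ x → gridWalks x q 0 0 M) (sym (pred[m∸n]≡m∸[1+n] a i)))))
    ... | no i≮a with refl ← ≤-antisym i≤a (≮⇒≥ i≮a) =
      trans (cong (λ x → canTop x * (Y + Zᵗ)) (n∸n≡0 a)) (sym (cong (λ x → canTop x * (W + gridWalks (pred x) q 0 0 M)) (n∸n≡0 a)))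
    bottomStep : B ≡ canBottom p q * (W + gridWalks p (pred q) 0 0 M)
    bottomStep with j <? bb
    ... | yes j<bb = cong (canBottom p q *_) (cong₂ _+_ Y≡W (trans (#fillings≡gridWalks M i (suc j) i≤a j<bb)
                                                                (cong (λ x → gridWalks p x 0 0 M) (sym (pred[m∸n]≡m∸[1+n] bb j)))))
    ... | no j≮bb with refl ← ≤-antisym j≤bb (≮⇒≥ j≮bb) =
      trans (cong (λ x → canBottom p x * (Y + Zᵇ)) (n∸n≡0 bb))
            (sym (cong (λ x → canBottom p x * (W + gridWalks p (pred x) 0 0 M)) (n∸n≡0 bb)))
    regroup : ∀ t b y z w → t * (y + z) + b * (y + w) ≡ (t + b) * y + t * z + b * w
    regroup = solve-∀

  #SYTplus≡gridWalks : ∀ k → #SYTplus N pos k ≡ gridWalks a bb 0 0 (N + k)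
  #SYTplus≡gridWalks k =
    trans (#SYTplus≡#fillings k)
          (trans (#fillings-cong (N + k) nothingFinished) (#fillings≡gridWalks (N + k) 0 0 z≤n z≤n))
    where
    nothingFinished : ∀ c → false ≡ finishedFirst 0 0 c
    nothingFinished c with toℕ c <ᵇ a
    ... | true  = refl
    ... | false = refl

module Counts where

  open import Data.Nat
  open import Data.Nat.Properties
  open import Data.Bool using (true; false; if_then_else_; _∧_)
  open import Data.Fin using (Fin; toℕ)
  open import Data.List using (List; []; _∷_; map; filter; cartesianProduct; applyUpTo; upTo)
  open import Data.Nat.ListAction using (sum)
  open import Data.Product using (_×_; _,_; proj₁; proj₂)
  open import Relation.Binary.PropositionalEquality
  open import Relation.Nullary using (Dec; yes; no; does)
  open import Function using (_∘_; id; mk⇔)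
  open import Relation.Nullary.Decidable using (_×-dec_; does-⇔)
  open import Defs
  open Prelude
  open Enumeration using (listSum; listSum-cong; listSum-++; listSum-map; length-filter)
  open TwoRowWalks using (gridWalks; gridTotal; gridWalks-tooShort; gridWalks-[1+b]-b-suc)

  #SYTplus-reindex : ∀ {N N′} (e : N ≡ N′) {pos : Fin N → ℕ × ℕ} {pos′ : Fin N′ → ℕ × ℕ} k →
    (∀ c → pos c ≡ pos′ (subst Fin e c)) → #SYTplus N pos k ≡ #SYTplus N′ pos′ k
  #SYTplus-reindex {N} refl {pos} {pos′} k pos≗pos′ =
    trans (length-filter (IsSYTplus? pos (N + k)) Ss)
          (trans (listSum-cong Ss (λ S → cong b2n (does-⇔ (mk⇔ (moved pos≗pos′) (moved (sym ∘ pos≗pos′)))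
                                                         (IsSYTplus? pos (N + k) S) (IsSYTplus? pos′ (N + k) S))))
                 (sym (length-filter (IsSYTplus? pos′ (N + k)) Ss)))
    where
    Ss = allFuns (allSubsets (N + k)) N
    moved : ∀ {p p′ : Fin N → ℕ × ℕ} → (∀ c → p c ≡ p′ c) → ∀ {S} → IsSYTplus p (N + k) S → IsSYTplus p′ (N + k) S
    moved p≗p′ (live , cov , disj , incr) =
      live , cov , disj , λ u v u≢v nw → incr u v u≢v (subst₂ NW (sym (p≗p′ u)) (sym (p≗p′ v)) nw)

  toℕ-subst : ∀ {N N′} (e : N ≡ N′) (c : Fin N) → toℕ (subst Fin e c) ≡ toℕ c
  toℕ-subst refl c = refl

  2b+1≡[1+b]+b : ∀ b → 2 * b + 1 ≡ suc b + b
  2b+1≡[1+b]+b b = trans (+-comm (2 * b) 1) (cong (λ x → suc (b + x)) (+-identityʳ b))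

  #SYTplus-twoRow : ∀ b k → #SYTplus (2 * b + 1) (posTwoRow b) k ≡ gridWalks (suc b) b 0 0 (2 * b + 1 + k)
  #SYTplus-twoRow b k =
    trans (#SYTplus-reindex e k (λ c → trans (samePos (toℕ c)) (cong S.cellPos (sym (toℕ-subst e c)))))
          (trans (S.#SYTplus≡gridWalks k) (cong (λ x → gridWalks (suc b) b 0 0 (x + k)) (sym e)))
    where
    module S = TwoRowShape (suc b) 0 b (+-identityʳ (suc b))
    e = 2b+1≡[1+b]+b b
    samePos : ∀ m → (if m ≤ᵇ b then (0 , m) else (1 , m ∸ suc b)) ≡ S.cellPos m
    samePos zero    = refl
    samePos (suc m) rewrite +-identityʳ m = refl

  #SYTplus-skew : ∀ b k → #SYTplus (2 * b) (posSkew b) k ≡ gridWalks b b 0 0 (2 * b + k)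
  #SYTplus-skew b k =
    trans (#SYTplus-reindex e k (λ c → trans (samePos (toℕ c)) (cong S.cellPos (sym (toℕ-subst e c)))))
          (trans (S.#SYTplus≡gridWalks k) (cong (λ x → gridWalks b b 0 0 (x + k)) (sym e)))
    where
    module S = TwoRowShape b 1 b (+-comm b 1)
    e : 2 * b ≡ b + b
    e = cong (b +_) (+-identityʳ b)
    samePos : ∀ m → (if suc m ≤ᵇ b then (0 , suc m) else (1 , m ∸ b)) ≡ S.cellPos m
    samePos m rewrite +-comm m 1 = refl

  listSum-filter : {A : Set} {P : A → Set} (P? : ∀ x → Dec (P x)) (g : A → ℕ) (xs : List A) →
    sum (map g (filter P? xs)) ≡ listSum (λ x → b2n (does (P? x)) * g x) xs
  listSum-filter P? g []       = refl
  listSum-filter P? g (x ∷ xs) with does (P? x)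
  ... | true  = cong₂ _+_ (sym (*-identityˡ (g x))) (listSum-filter P? g xs)
  ... | false = listSum-filter P? g xs

  listSum-cartesianProduct : {A B : Set} (h : A × B → ℕ) (xs : List A) (ys : List B) →
    listSum h (cartesianProduct xs ys) ≡ listSum (λ x → listSum (λ y → h (x , y)) ys) xs
  listSum-cartesianProduct h []       ys = refl
  listSum-cartesianProduct h (x ∷ xs) ys =
    trans (listSum-++ h (map (x ,_) ys) _) (cong₂ _+_ (listSum-map h (x ,_) ys) (listSum-cartesianProduct h xs ys))

  listSum-applyUpTo : (g f : ℕ → ℕ) (n : ℕ) → listSum g (applyUpTo f n) ≡ sumBelow n (g ∘ f)
  listSum-applyUpTo g f zero    = refl
  listSum-applyUpTo g f (suc n) = cong (g (f 0) +_) (listSum-applyUpTo g (f ∘ suc) n)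

  b2n-∧ : ∀ x y → b2n (x ∧ y) ≡ b2n x * b2n y
  b2n-∧ true  y = sym (+-identityʳ (b2n y))
  b2n-∧ false y = refl

  b2n-≟ : ∀ x y → b2n (does (x ≟ y)) ≡ δ x y
  b2n-≟ zero    zero    = refl
  b2n-≟ zero    (suc y) = refl
  b2n-≟ (suc x) zero    = refl
  b2n-≟ (suc x) (suc y) = b2n-≟ x y

  δ-+ˡ : ∀ c k m → δ (c + k) (c + m) ≡ δ k m
  δ-+ˡ zero    k m = refl
  δ-+ˡ (suc c) k m = δ-+ˡ c k m

  sumBelow-δ-shifted : ∀ n c (g : ℕ → ℕ) →
    sumBelow (suc n) (λ k → δ (c + k) n * g k) ≡ (if c ≤ᵇ n then g (n ∸ c) else 0)
  sumBelow-δ-shifted n c g with c ≤? n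
  ... | yes c≤n rewrite ≤⇒≤ᵇ≡true c≤n =
    trans (sumBelow-cong (suc n) (λ k → cong (λ m → δ (c + k) m * g k) (sym (m+[n∸m]≡n c≤n))))
          (trans (sumBelow-cong (suc n) (λ k → cong (_* g k) (δ-+ˡ c k (n ∸ c))))
                 (sumBelow-δ (suc n) (n ∸ c) g (s≤s (m∸n≤m n c))))
  ... | no c≰n rewrite >⇒≤ᵇ≡false (≰⇒> c≰n) =
    sumBelow-zero (suc n) (λ k → cong (_* g k) (δ-≢ (λ c+k≡n → c≰n (subst (c ≤_) c+k≡n (m≤m+n c k)))))

  unionCount-unfold : ∀ bmin n f → unionCount bmin n f ≡
    sumBelow (suc n) (λ b → b2n (does (bmin ≤? b)) * (if 2 * b + 1 ≤ᵇ n then f b (n ∸ (2 * b + 1)) else 0))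
  unionCount-unfold bmin n f = begin
      unionCount bmin n f
        ≡⟨ listSum-filter C (λ p → f (proj₁ p) (proj₂ p)) (cartesianProduct U U) ⟩
      listSum (λ p → b2n (does (C p)) * f (proj₁ p) (proj₂ p)) (cartesianProduct U U)
        ≡⟨ listSum-cartesianProduct (λ p → b2n (does (C p)) * f (proj₁ p) (proj₂ p)) U U ⟩
      listSum (λ b → listSum (λ k → term b k) U) U
        ≡⟨ listSum-applyUpTo (λ b → listSum (λ k → term b k) U) id (suc n) ⟩
      sumBelow (suc n) (λ b → listSum (λ k → term b k) U)
        ≡⟨ sumBelow-cong (suc n) (λ b → listSum-applyUpTo (term b) id (suc n)) ⟩
      sumBelow (suc n) (λ b → sumBelow (suc n) (term b))
        ≡⟨ sumBelow-cong (suc n) perB ⟩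
      sumBelow (suc n) (λ b → b2n (does (bmin ≤? b)) * (if 2 * b + 1 ≤ᵇ n then f b (n ∸ (2 * b + 1)) else 0)) ∎
    where
    open ≡-Reasoning
    U = upTo (suc n)
    C : (p : ℕ × ℕ) → Dec (bmin ≤ proj₁ p × 2 * proj₁ p + proj₂ p + 1 ≡ n)
    C p = (bmin ≤? proj₁ p) ×-dec (2 * proj₁ p + proj₂ p + 1 ≟ n)
    term : ℕ → ℕ → ℕ
    term b k = b2n (does (C (b , k))) * f b k
    perB : ∀ b → sumBelow (suc n) (term b) ≡ b2n (does (bmin ≤? b)) * (if 2 * b + 1 ≤ᵇ n then f b (n ∸ (2 * b + 1)) else 0)
    perB b = trans (sumBelow-cong (suc n) factor)
                   (trans (sumBelow-*ˡ (suc n) (b2n (does (bmin ≤? b))) (λ k → δ (2 * b + 1 + k) n * f b k)) (cong (b2n (does (bmin ≤? b)) *_) (sumBelow-δ-shifted n (2 * b + 1) (f b))))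
      where
      reorder : ∀ k → 2 * b + k + 1 ≡ 2 * b + 1 + k
      reorder k = trans (+-assoc (2 * b) k 1) (trans (cong (2 * b +_) (+-comm k 1)) (sym (+-assoc (2 * b) 1 k)))
      factor : ∀ k → term b k ≡ b2n (does (bmin ≤? b)) * (δ (2 * b + 1 + k) n * f b k)
      factor k = trans (cong (_* f b k) (trans (b2n-∧ (does (bmin ≤? b)) (does (2 * b + k + 1 ≟ n))) (cong (b2n (does (bmin ≤? b)) *_)
                                                 (trans (b2n-≟ (2 * b + k + 1) n) (cong (λ m → δ m n) (reorder k))))))
                       (*-assoc (b2n (does (bmin ≤? b))) _ (f b k))

  countTwoRow≡gridTotal : ∀ n → countTwoRow n ≡ gridTotal (suc n) 0 0 n
  countTwoRow≡gridTotal n =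
    trans (unionCount-unfold 0 n F) (sumBelow-cong (suc n) {f = λ b → 1 * term b} (λ b → trans (*-identityˡ (term b)) (byLength b)))
    where
    F : ℕ → ℕ → ℕ
    F b k = #SYTplus (2 * b + 1) (posTwoRow b) k
    term : ℕ → ℕ
    term b = if 2 * b + 1 ≤ᵇ n then F b (n ∸ (2 * b + 1)) else 0
    byLength : ∀ b → term b ≡ gridWalks (suc b) b 0 0 n
    byLength b = byDec (2 * b + 1 ≤? n)
      where
      byDec : Dec (2 * b + 1 ≤ n) → term b ≡ gridWalks (suc b) b 0 0 n
      byDec (yes ≤n) = trans (if-true (≤⇒≤ᵇ≡true ≤n))
                             (trans (#SYTplus-twoRow b (n ∸ (2 * b + 1))) (cong (gridWalks (suc b) b 0 0) (m+[n∸m]≡n ≤n)))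
      byDec (no ≰n)  = trans (if-false (>⇒≤ᵇ≡false (≰⇒> ≰n)))
                             (sym (gridWalks-tooShort n (suc b) b (subst (n <_) (2b+1≡[1+b]+b b) (≰⇒> ≰n))))

  skew-length : ∀ n b → 2 * suc b + 1 ≤ n → 2 * suc b + (n ∸ (2 * suc b + 1)) ≡ n ∸ 1
  skew-length n b ≤n = begin
      2 * suc b + (n ∸ c)             ≡⟨ m+n∸n≡m (2 * suc b + (n ∸ c)) 1 ⟨
      2 * suc b + (n ∸ c) + 1 ∸ 1     ≡⟨ cong (_∸ 1) (+-assoc (2 * suc b) (n ∸ c) 1) ⟩
      2 * suc b + ((n ∸ c) + 1) ∸ 1   ≡⟨ cong (λ x → 2 * suc b + x ∸ 1) (+-comm (n ∸ c) 1) ⟩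
      2 * suc b + (1 + (n ∸ c)) ∸ 1   ≡⟨ cong (_∸ 1) (+-assoc (2 * suc b) 1 (n ∸ c)) ⟨
      c + (n ∸ c) ∸ 1                 ≡⟨ cong (_∸ 1) (m+[n∸m]≡n ≤n) ⟩
      n ∸ 1                           ∎
    where
    open ≡-Reasoning
    c = 2 * suc b + 1

  skew-tooShort : ∀ n b → n < 2 * suc b + 1 → n ∸ 1 < suc b + suc b
  skew-tooShort n b n< = s≤s (∸-monoˡ-≤ 1 (≤-pred (subst (n <_) (2b+1≡[1+b]+b (suc b)) n<)))

  countSkew≡sum : ∀ n → countSkew n ≡ sumBelow n (λ b → gridWalks (suc b) (suc b) 0 0 (n ∸ 1))
  countSkew≡sum n =
    trans (unionCount-unfold 1 n F) (sumBelow-cong n {f = λ b → 1 * term b} (λ b → trans (*-identityˡ (term b)) (byLength b)))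
    where
    F : ℕ → ℕ → ℕ
    F b k = #SYTplus (2 * b) (posSkew b) k
    term : ℕ → ℕ
    term b = if 2 * suc b + 1 ≤ᵇ n then F (suc b) (n ∸ (2 * suc b + 1)) else 0
    byLength : ∀ b → term b ≡ gridWalks (suc b) (suc b) 0 0 (n ∸ 1)
    byLength b = byDec (2 * suc b + 1 ≤? n)
      where
      byDec : Dec (2 * suc b + 1 ≤ n) → term b ≡ gridWalks (suc b) (suc b) 0 0 (n ∸ 1)
      byDec (yes ≤n) = trans (if-true (≤⇒≤ᵇ≡true ≤n))
                             (trans (#SYTplus-skew (suc b) (n ∸ (2 * suc b + 1)))
                                    (cong (gridWalks (suc b) (suc b) 0 0) (skew-length n b ≤n)))
      byDec (no ≰n)  = trans (if-false (>⇒≤ᵇ≡false (≰⇒> ≰n)))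
                             (sym (gridWalks-tooShort (n ∸ 1) (suc b) (suc b) (skew-tooShort n b (≰⇒> ≰n))))

  -- A walk from (b + 1, b) starts by staying or by moving to (b, b), where the
  -- walks counting the skew shape start.
  countTwoRow-suc : ∀ m → countTwoRow (2 + m) ≡ countTwoRow (1 + m) + countSkew (2 + m)
  countTwoRow-suc m = begin
      countTwoRow (2 + m)
        ≡⟨ countTwoRow≡gridTotal (2 + m) ⟩
      sumBelow (3 + m) (λ b → gridWalks (suc b) b 0 0 (2 + m))
        ≡⟨ sumBelow-cong (3 + m) (λ b → gridWalks-[1+b]-b-suc b (1 + m)) ⟩
      sumBelow (3 + m) (λ b → gridWalks (suc b) b 0 0 (1 + m) + gridWalks b b 0 0 (1 + m))
        ≡⟨ sumBelow-+ (3 + m) (λ b → gridWalks (suc b) b 0 0 (1 + m)) (λ b → gridWalks b b 0 0 (1 + m)) ⟩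
      sumBelow (3 + m) (λ b → gridWalks (suc b) b 0 0 (1 + m)) + sumBelow (3 + m) (λ b → gridWalks b b 0 0 (1 + m))
        ≡⟨ cong (_+ sumBelow (3 + m) (λ b → gridWalks b b 0 0 (1 + m))) (sumBelow-suc (2 + m) (λ b → gridWalks (suc b) b 0 0 (1 + m))) ⟩
      sumBelow (2 + m) (λ b → gridWalks (suc b) b 0 0 (1 + m)) + gridWalks (3 + m) (2 + m) 0 0 (1 + m)
        + sumBelow (3 + m) (λ b → gridWalks b b 0 0 (1 + m))
        ≡⟨ cong (λ x → sumBelow (2 + m) (λ b → gridWalks (suc b) b 0 0 (1 + m)) + x + sumBelow (3 + m) (λ b → gridWalks b b 0 0 (1 + m)))
                (gridWalks-tooShort (1 + m) (3 + m) (2 + m) (s≤s (s≤s (≤-trans (n≤1+n m) (m≤m+n (1 + m) (2 + m)))))) ⟩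
      sumBelow (2 + m) (λ b → gridWalks (suc b) b 0 0 (1 + m)) + 0 + sumBelow (2 + m) (λ b → gridWalks (suc b) (suc b) 0 0 (1 + m))
        ≡⟨ cong₂ _+_ (trans (+-identityʳ _) (sym (countTwoRow≡gridTotal (1 + m)))) (sym (countSkew≡sum (2 + m))) ⟩
      countTwoRow (1 + m) + countSkew (2 + m) ∎
    where open ≡-Reasoning


module CatalanDifferences where

  open import Data.Nat
  open import Data.Nat.Properties using (n<1+n)
  import Data.Nat.Combinatorics as ℕC
  open import Relation.Binary.PropositionalEquality
  open import Defs using (Cat; countTwoRow)
  open Ballot using (ballot; ballot0-suc; walks1-FF≡ballot1; Cat≡ballot0; ballot1≡3C/)
  open TwoRowWalks using (gridTotal≡walks)
  open Counts using (countTwoRow≡gridTotal)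

  countTwoRow≡ballot1 : ∀ m → countTwoRow (2 + m) ≡ ballot 1 (1 + m)
  countTwoRow≡ballot1 m =
    trans (countTwoRow≡gridTotal (2 + m)) (trans (gridTotal≡walks (2 + m) (3 + m) 0 0 1 refl (n<1+n (2 + m))) (walks1-FF≡ballot1 m))

  Cat-suc : ∀ m → Cat (2 + m) ≡ countTwoRow (2 + m) + Cat (1 + m)
  Cat-suc m = trans (Cat≡ballot0 (2 + m)) (trans (ballot0-suc (1 + m))
                (cong₂ _+_ (sym (countTwoRow≡ballot1 m)) (sym (Cat≡ballot0 (1 + m)))))

  countTwoRow-closedForm : ∀ k → let n = 3 + k in countTwoRow n ≡ (3 * ((2 * n ∸ 2) ℕC.C n)) / suc n
  countTwoRow-closedForm k = trans (countTwoRow≡ballot1 (1 + k)) (ballot1≡3C/ k)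

open import Defs
open import Data.Nat using (ℕ; _≤_; _∸_; _*_; _/_; suc; s≤s; z≤n)
open import Data.Nat.Combinatorics using (_C_)
open import Data.Integer using (ℤ; +_; _-_; _+_) renaming (_*_ to _*ℤ_)
open import Data.Integer.Tactic.RingSolver using (solve-∀)
open import Data.Product using (_×_; _,_)
open import Relation.Binary.PropositionalEquality using (_≡_; cong; cong₂; trans; sym; module ≡-Reasoning)
open Counts using (countTwoRow-suc)
open CatalanDifferences

corollary9 : (n : ℕ) → 3 ≤ n →
    ((+ countTwoRow n ≡ + Cat n - + Cat (n ∸ 1)) ×
    (countTwoRow n ≡ (3 * ((2 * n ∸ 2) C n)) / suc n)) ×
    (+ countSkew n ≡ + Cat n - (+ 2) *ℤ (+ Cat (n ∸ 1)) + + Cat (n ∸ 2))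
corollary9 (suc (suc (suc k))) (s≤s (s≤s (s≤s z≤n))) = (twoRow-difference , countTwoRow-closedForm k) , skew-difference
  where
  open ≡-Reasoning
  T₂ = countTwoRow (2 ℕ.+ k)
  S  = countSkew (3 ℕ.+ k)
  C₁ = Cat (1 ℕ.+ k)
  difference : ∀ x y → x ≡ (x + y) - y
  difference = solve-∀
  secondDifference : ∀ s t c → s ≡ ((t + s) + (t + c)) - (+ 2) *ℤ (t + c) + c
  secondDifference = solve-∀
  twoRow-difference : + countTwoRow (3 ℕ.+ k) ≡ + Cat (3 ℕ.+ k) - + Cat (2 ℕ.+ k)
  twoRow-difference = trans (difference (+ countTwoRow (3 ℕ.+ k)) (+ Cat (2 ℕ.+ k)))
                            (cong (λ c → + c - + Cat (2 ℕ.+ k)) (sym (Cat-suc (1 ℕ.+ k))))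
  Cat[3+k] : Cat (3 ℕ.+ k) ≡ (T₂ ℕ.+ S) ℕ.+ (T₂ ℕ.+ C₁)
  Cat[3+k] = trans (Cat-suc (1 ℕ.+ k)) (cong₂ ℕ._+_ (countTwoRow-suc (suc k)) (Cat-suc k))
  skew-difference : + S ≡ + Cat (3 ℕ.+ k) - (+ 2) *ℤ (+ Cat (2 ℕ.+ k)) + + C₁
  skew-difference = begin
    + S
      ≡⟨ secondDifference (+ S) (+ T₂) (+ C₁) ⟩
    + ((T₂ ℕ.+ S) ℕ.+ (T₂ ℕ.+ C₁)) - (+ 2) *ℤ (+ (T₂ ℕ.+ C₁)) + + C₁
      ≡⟨ cong₂ (λ x y → + x - (+ 2) *ℤ (+ y) + + C₁) (sym Cat[3+k]) (sym (Cat-suc k)) ⟩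
    + Cat (3 ℕ.+ k) - (+ 2) *ℤ (+ Cat (2 ℕ.+ k)) + + C₁ ∎
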